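{- Let $C$ be a multiplicatively disjoint arithmetic circuit. For each gate $v$ of $C$ let $C_v$ be the subcircuit of $C$ with output $v$ and $f_v$ the polynomial computed by $C_v$. Then there is a relaxed stack branching program $G$ of size at most $2|C|(|C|+1)+3|C|$ such that for each gate $v$ of $C$ there are vertices $v_-,v_+$ of $G$ and an integer $m_v\le 4|C_v|$ with (i) $f_v=f_{v_-,v_+,m_v}$, and (ii) there is no stack-realizable walk from $v_-$ to $v_+$ in $G$ that is shorter than $m_v$.
   Context: An arithmetic circuit over a field $\mathbb{F}$ is a DAG whose gates have fanin $0$ (inputs labeled by constants of $\mathbb{F}$ or variables) or fanin $2$ (labeled $+$ or $\times$); size $|C|$ = number of gates. It is multiplicatively disjoint if for every $\times$-gate the subcircuits rooted at its two children are disjoint. Stack operations over a finite symbol set $S$: $\mathrm{push}(s)$, $\mathrm{pop}(s)$ ($s\in S$), $\mathrm{nop}$. Realizable sequences: the empty sequence is realizable; if $P$ is realizable then $\mathrm{push}(s)P\,\mathrm{pop}(s)$, $\mathrm{nop}\,P$ and $P\,\mathrm{nop}$ are realizable; if $P,Q$ are realizable so is $PQ$. A relaxed stack branching program is a (not necessarily acyclic) directed graph with edge weights $w:E\to\mathbb{F}\cup\{X_1,X_2,\dots\}$ and edge labels $\sigma$ by stack operations. A walk (vertices/edges may repeat) has weight the product of its edge weights and is stack-realizable if its sequence of edge operations is realizable. For vertices $u,v$ and $m\in\mathbb{N}$, $f_{u,v,m}$ is the sum of weights of all stack-realizable $u$-$v$-walks of length $m$. Size = number of vertices. -}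

module Defs where

open import Level using (Level; _⊔_) renaming (suc to lsuc)
open import Data.Nat using (ℕ; zero; suc)
open import Data.Fin using (Fin; zero; suc)
open import Data.Fin.Subset using (Subset; ⁅_⁆; _∪_; _∩_; ⊥)
open import Data.Vec using (_∷_)
open import Data.List using (List; []; _∷_; _++_; [_]; map; foldr; concatMap)

open import Data.Maybe using (Maybe; just; nothing; maybe; Is-just)
open import Data.Product using (Σ; _×_; _,_; proj₁; proj₂)
open import Data.Unit.Polymorphic using (⊤)
open import Data.List.Relation.Unary.Unique.Propositional using (Unique)
open import Data.List.Membership.Propositional using (_∈_)
open import Function.Bundles using (_⇔_)
open import Relation.Nullary using (¬_)
open import Relation.Binary.PropositionalEquality using (_≡_)
open import Algebra.Bundles using (CommutativeRing)

consecutive : ∀ {a} {A : Set a} → List A → List (A × A)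
consecutive [] = []
consecutive (x ∷ []) = []
consecutive (x ∷ y ∷ r) = (x , y) ∷ consecutive (y ∷ r)

record Field (c ℓ : Level) : Set (lsuc (c ⊔ ℓ)) where
  field
    commutativeRing : CommutativeRing c ℓ
  open CommutativeRing commutativeRing public
  field
    0≉1     : ¬ (0# ≈ 1#)
    inverse : ∀ x → ¬ (x ≈ 0#) → Σ Carrier λ y → (x * y) ≈ 1#

-- Formal polynomials over F in the variables X₀, X₁, X₂, …
-- (the paper's X₁, X₂, … ; the index shift is immaterial).
-- A polynomial is a term modulo the congruence _≋_ generated by the
-- commutative-ring axioms and the requirement that constants form a
-- ring homomorphic copy of F; Expr/≋ is the free commutative
-- F-algebra on the variables, i.e. the polynomial ring F[X₀,X₁,…].

module _ {c ℓ} (F : Field c ℓ) where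
  private module F = Field F

  data Expr : Set c where
    con  : F.Carrier → Expr
    var  : ℕ → Expr
    _⊕_  : Expr → Expr → Expr
    _⊗_  : Expr → Expr → Expr

  infixl 6 _⊕_
  infixl 7 _⊗_
  infix 4 _≋_

  data _≋_ : Expr → Expr → Set (c ⊔ ℓ) where
    ≋-refl  : ∀ {p} → p ≋ p
    ≋-sym   : ∀ {p q} → p ≋ q → q ≋ p
    ≋-trans : ∀ {p q r} → p ≋ q → q ≋ r → p ≋ r
    ⊕-cong  : ∀ {p p′ q q′} → p ≋ p′ → q ≋ q′ → p ⊕ q ≋ p′ ⊕ q′
    ⊗-cong  : ∀ {p p′ q q′} → p ≋ p′ → q ≋ q′ → p ⊗ q ≋ p′ ⊗ q′
    ⊕-assoc : ∀ p q r → (p ⊕ q) ⊕ r ≋ p ⊕ (q ⊕ r)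
    ⊕-comm  : ∀ p q → p ⊕ q ≋ q ⊕ p
    ⊕-idʳ   : ∀ p → p ⊕ con F.0# ≋ p
    ⊕-invʳ  : ∀ p → p ⊕ (con (F.- F.1#) ⊗ p) ≋ con F.0#
    ⊗-assoc : ∀ p q r → (p ⊗ q) ⊗ r ≋ p ⊗ (q ⊗ r)
    ⊗-comm  : ∀ p q → p ⊗ q ≋ q ⊗ p
    ⊗-idʳ   : ∀ p → p ⊗ con F.1# ≋ p
    distribʳ : ∀ p q r → (p ⊕ q) ⊗ r ≋ (p ⊗ r) ⊕ (q ⊗ r)
    con-cong : ∀ {a b} → a F.≈ b → con a ≋ con b
    con-+   : ∀ a b → con (a F.+ b) ≋ con a ⊕ con b
    con-*   : ∀ a b → con (a F.* b) ≋ con a ⊗ con b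

  sumE : List Expr → Expr
  sumE = foldr _⊕_ (con F.0#)

  prodE : List Expr → Expr
  prodE = foldr _⊗_ (con F.1#)

-- A circuit with s gates is given in topological
-- order: the newest gate is index zero and may only refer to the
-- (strictly older) gates of the remaining circuit.  This encodes an
-- arbitrary DAG of fanin-0 / fanin-2 gates; size |C| = s.

  data GateOp : Set where
    plus times : GateOp

  data Gate (n : ℕ) : Set c where
    const : F.Carrier → Gate n
    input : ℕ → Gate n
    op    : GateOp → Fin n → Fin n → Gate n

  data Circuit : ℕ → Set c where
    []  : Circuit 0
    _∷_ : ∀ {n} → Gate n → Circuit n → Circuit (suc n)

  subGates : ∀ {n} → Circuit n → Fin n → Subset n
  subGates (const a ∷ C) zero = ⁅ zero ⁆
  subGates (input i ∷ C) zero = ⁅ zero ⁆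
  subGates (op o l r ∷ C) zero = true ∷ (subGates C l ∪ subGates C r)
    where open import Data.Bool using (true)
  subGates (g ∷ C) (suc v) = false ∷ subGates C v
    where open import Data.Bool using (false)

  poly : ∀ {n} → Circuit n → Fin n → Expr
  poly (const a ∷ C) zero = con a
  poly (input i ∷ C) zero = var i
  poly (op plus  l r ∷ C) zero = poly C l ⊕ poly C r
  poly (op times l r ∷ C) zero = poly C l ⊗ poly C r
  poly (g ∷ C) (suc v) = poly C v

  MultDisjoint : ∀ {n} → Circuit n → Set
  MultDisjoint [] = ⊤
  MultDisjoint (const a ∷ C) = MultDisjoint C
  MultDisjoint (input i ∷ C) = MultDisjoint C
  MultDisjoint (op plus l r ∷ C) = MultDisjoint C
  MultDisjoint (op times l r ∷ C) = (subGates C l ∩ subGates C r ≡ ⊥) × MultDisjoint C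

data StackOp (k : ℕ) : Set where
  push pop : Fin k → StackOp k
  nop      : StackOp k

data Realizable {k : ℕ} : List (StackOp k) → Set where
  empty : Realizable []
  wrap  : ∀ s {P} → Realizable P → Realizable (push s ∷ P ++ [ pop s ])
  nopˡ  : ∀ {P} → Realizable P → Realizable (nop ∷ P)
  nopʳ  : ∀ {P} → Realizable P → Realizable (P ++ [ nop ])
  cat   : ∀ {P Q} → Realizable P → Realizable Q → Realizable (P ++ Q)

module _ {c ℓ} (F : Field c ℓ) where
  private module F = Field F

  data Weight : Set c where
    cst : F.Carrier → Weight
    X   : ℕ → Weight

  weightExpr : Weight → Expr F
  weightExpr (cst a) = con a
  weightExpr (X i)   = var i

  -- a directed graph on N vertices (size N) with stack symbols Fin k:
  -- edge u v = just (w , o) iff there is an edge u→v of weight w and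
  -- stack label o
  record RSBP (N k : ℕ) : Set c where
    field
      edge : Fin N → Fin N → Maybe (Weight × StackOp k)

  module _ {N k} (G : RSBP N k) where
    open RSBP G

    -- xs is (the vertex sequence of) a u-v-walk of length m
    data IsWalk : Fin N → Fin N → ℕ → List (Fin N) → Set c where
      here : ∀ {u} → IsWalk u u 0 (u ∷ [])
      step : ∀ {u x v m ys} → Is-just (edge u x) →
             IsWalk x v m (x ∷ ys) → IsWalk u v (suc m) (u ∷ x ∷ ys)

    edgeOps : Fin N × Fin N → List (StackOp k)
    edgeOps (x , y) = maybe (λ e → proj₂ e ∷ []) [] (edge x y)

    edgeWeights : Fin N × Fin N → List (Expr F)
    edgeWeights (x , y) = maybe (λ e → weightExpr (proj₁ e) ∷ []) [] (edge x y)

    walkOps : List (Fin N) → List (StackOp k)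
    walkOps xs = concatMap edgeOps (consecutive xs)

    walkWeights : List (Fin N) → List (Expr F)
    walkWeights xs = concatMap edgeWeights (consecutive xs)

    walkWeight : List (Fin N) → Expr F
    walkWeight xs = prodE F (walkWeights xs)

    StackWalk : Fin N → Fin N → ℕ → List (Fin N) → Set c
    StackWalk u v m xs = IsWalk u v m xs × Realizable (walkOps xs)

    -- p ≋ f_{u,v,m}: p equals the sum of the weights of all
    -- stack-realizable u-v-walks of length m (L enumerates them without
    -- repetition; walks are identified with their vertex sequences,
    -- which determine them since G has at most one edge u→v)
    IsPathPoly : Fin N → Fin N → ℕ → Expr F → Set (c ⊔ ℓ)
    IsPathPoly u v m p =
      Σ (List (List (Fin N))) λ L →
        Unique L ×
        (∀ xs → (xs ∈ L) ⇔ StackWalk u v m xs) ×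
        _≋_ F p (sumE F (Data.List.map walkWeight L))

module Submission where

-- Gate k gets vertices k₋, k₊,
-- a middle vertex and a padding chain.  A leaf is one edge k₋ → k₊.  For
-- k = l × r, k₋ pushes (k , mid) and enters l₋; the exit of l pops it and moves
-- on to r₋.  For k = l + r, k₋ pushes the head of a padding chain and enters l₋
-- or r₋; their exits pop it, and the chain to k₊ equalises the branch lengths.
--
-- The walks W_k of every gate are listed explicitly; the invariant
-- GateSpec says that they are distinct stack-balanced walks from k₋ of length m_k
-- with weights summing to f_k, and that every walk from k₋ on which the stack
-- machine does not fail either is incomplete or extends a walk of W_k.

open import Defs
open import Data.Nat using (ℕ; _+_; _*_; _≤_; _<_)
open import Data.Fin using (Fin)
open import Data.Fin.Subset using (∣_∣)
open import Data.Product using (Σ; _×_)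
open import Data.List using (List)
open import Relation.Nullary using (¬_)
open import Data.Nat using (zero; suc; z≤n)
open import Data.Maybe using (Maybe)
open import Data.Product using (_,_)
open import Relation.Binary.Definitions using (DecidableEquality)

module StackMachine where

  open import Data.Fin as Fin using (Fin)
  open import Data.List using (List; []; _∷_; _++_; [_]; map)
  open import Data.List.Properties using (map-++)
  open import Data.List.Relation.Unary.All using (All; []; _∷_)
  open import Data.Maybe as Maybe using (Maybe; just; nothing; _>>=_)
  open import Data.Product using (_×_; _,_)
  open import Data.Empty using (⊥-elim)
  open import Data.Unit using (⊤)
  open import Relation.Nullary using (¬_; Dec; yes; no)
  open import Relation.Binary.PropositionalEquality hiding ([_])
  open import Relation.Binary.Definitions using (DecidableEquality)
  open import Defs

  ifDec : ∀ {a p} {A : Set a} {Q : Set p} → Dec Q → A → A → A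
  ifDec (yes _) x y = x
  ifDec (no _) x y = y

  ifDec-yes : ∀ {a p} {A : Set a} {Q : Set p} (d : Dec Q) {x y : A} → Q → ifDec d x y ≡ x
  ifDec-yes (yes _) q = refl
  ifDec-yes (no ¬q) q = ⊥-elim (¬q q)

  ifDec-no : ∀ {a p} {A : Set a} {Q : Set p} (d : Dec Q) {x y : A} → ¬ Q → ifDec d x y ≡ y
  ifDec-no (yes q) ¬q = ⊥-elim (¬q q)
  ifDec-no (no _) ¬q = refl

  ifDec-just : ∀ {a p} {A : Set a} {Q : Set p} (d : Dec Q) {x e : A} →
               ifDec d (just x) nothing ≡ just e → Q × x ≡ e
  ifDec-just (yes q) refl = q , refl
  ifDec-just (no _) ()

  -- Stack operations over an arbitrary symbol type, and the realizable
  -- (here: balanced) sequences, defined exactly as `Realizable` for Fin k;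
  -- the construction uses vertices of the graph as stack symbols.
  data Op {a} (A : Set a) : Set a where
    push↑ pop↓ : A → Op A
    noop : Op A

  data Balanced {a} {A : Set a} : List (Op A) → Set a where
    empty : Balanced []
    wrap  : ∀ x {P} → Balanced P → Balanced (push↑ x ∷ P ++ [ pop↓ x ])
    nopˡ  : ∀ {P} → Balanced P → Balanced (noop ∷ P)
    nopʳ  : ∀ {P} → Balanced P → Balanced (P ++ [ noop ])
    cat   : ∀ {P Q} → Balanced P → Balanced Q → Balanced (P ++ Q)

  decodeOp : ∀ {k} → StackOp k → Op (Fin k)
  decodeOp (push x) = push↑ x
  decodeOp (pop x) = pop↓ x
  decodeOp nop = noop

  encodeOp : ∀ {a} {A : Set a} {k} → (A → Fin k) → Op A → StackOp k
  encodeOp e (push↑ x) = push (e x)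
  encodeOp e (pop↓ x) = pop (e x)
  encodeOp e noop = nop

  Realizable⇒Balanced : ∀ {k} {P : List (StackOp k)} → Realizable P → Balanced (map decodeOp P)
  Realizable⇒Balanced empty = empty
  Realizable⇒Balanced (wrap x {P} R) rewrite map-++ decodeOp P [ pop x ] = wrap x (Realizable⇒Balanced R)
  Realizable⇒Balanced (nopˡ R) = nopˡ (Realizable⇒Balanced R)
  Realizable⇒Balanced (nopʳ {P} R) rewrite map-++ decodeOp P [ nop ] = nopʳ (Realizable⇒Balanced R)
  Realizable⇒Balanced (cat {P} {Q} R S) rewrite map-++ decodeOp P Q =
    cat (Realizable⇒Balanced R) (Realizable⇒Balanced S)

  Balanced⇒Realizable : ∀ {a} {A : Set a} {k} (e : A → Fin k) {P} →
                        Balanced P → Realizable (map (encodeOp e) P)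
  Balanced⇒Realizable e empty = empty
  Balanced⇒Realizable e (wrap x {P} R) rewrite map-++ (encodeOp e) P [ pop↓ x ] =
    wrap (e x) (Balanced⇒Realizable e R)
  Balanced⇒Realizable e (nopˡ R) = nopˡ (Balanced⇒Realizable e R)
  Balanced⇒Realizable e (nopʳ {P} R) rewrite map-++ (encodeOp e) P [ noop ] =
    nopʳ (Balanced⇒Realizable e R)
  Balanced⇒Realizable e (cat {P} {Q} R S) rewrite map-++ (encodeOp e) P Q =
    cat (Balanced⇒Realizable e R) (Balanced⇒Realizable e S)

  module Machine {a} {A : Set a} (_≟A_ : DecidableEquality A) where
    exec : Op A → List A → Maybe (List A)
    exec (push↑ x) st = just (x ∷ st)
    exec (pop↓ x) [] = nothing
    exec (pop↓ x) (y ∷ st) = ifDec (x ≟A y) (just st) nothing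
    exec noop st = just st

    run : List (Op A) → List A → Maybe (List A)
    run [] st = just st
    run (o ∷ P) st = exec o st >>= run P

    run-++ : ∀ P Q st → run (P ++ Q) st ≡ (run P st >>= run Q)
    run-++ [] Q st = refl
    run-++ (o ∷ P) Q st with exec o st
    ... | nothing = refl
    ... | just st′ = run-++ P Q st′

    balanced-run : ∀ {P} → Balanced P → ∀ st → run P st ≡ just st
    balanced-run empty st = refl
    balanced-run (wrap x {P} R) st
      rewrite run-++ P [ pop↓ x ] (x ∷ st) | balanced-run R (x ∷ st)
            | ifDec-yes (x ≟A x) {just st} {nothing} refl = refl
    balanced-run (nopˡ R) st = balanced-run R st
    balanced-run (nopʳ {P} R) st rewrite run-++ P [ noop ] st | balanced-run R st = refl
    balanced-run (cat {P} {Q} R S) st rewrite run-++ P Q st | balanced-run R st = balanced-run S st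

  module EncodedRun {a} {A : Set a} (_≟A_ : DecidableEquality A) {k} (e : A → Fin k)
                    (Good : A → Set) (e-injective : ∀ {x y} → Good x → Good y → e x ≡ e y → x ≡ y) where
    open Machine _≟A_ using (run)
    open Machine (Fin._≟_ {k}) using () renaming (run to runFin)

    GoodOp : Op A → Set
    GoodOp (push↑ x) = Good x
    GoodOp (pop↓ x) = Good x
    GoodOp noop = ⊤

    run-encode : ∀ P σ → All GoodOp P → All Good σ →
                 runFin (map decodeOp (map (encodeOp e) P)) (map e σ) ≡ Maybe.map (map e) (run P σ)
    run-encode [] σ _ _ = refl
    run-encode (push↑ x ∷ P) σ (gx ∷ gP) gσ = run-encode P (x ∷ σ) gP (gx ∷ gσ)
    run-encode (pop↓ x ∷ P) [] _ _ = refl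
    run-encode (pop↓ x ∷ P) (y ∷ σ) (gx ∷ gP) (gy ∷ gσ) with x ≟A y | e x Fin.≟ e y
    ... | yes refl | yes _ = run-encode P σ gP gσ
    ... | yes refl | no ne = ⊥-elim (ne refl)
    ... | no ne | yes eq = ⊥-elim (ne (e-injective gx gy eq))
    ... | no _ | no _ = refl
    run-encode (noop ∷ P) σ (_ ∷ gP) gσ = run-encode P σ gP gσ

module PolyAlgebra {c ℓ} (F : Field c ℓ) where

  open import Data.Nat using (zero; suc)
  open import Data.List using (List; []; _∷_; _++_; map; replicate; cartesianProduct)
  open import Data.List.Properties using (map-++)
  open import Data.List.Membership.Propositional using (_∈_)
  open import Data.List.Relation.Unary.Any using (here; there)
  open import Data.Product using (_,_; proj₁; proj₂)
  open import Relation.Binary.PropositionalEquality using (_≡_; refl)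

  private module F = Field F

  infix 4 _≈_
  _≈_ : Expr F → Expr F → Set _
  _≈_ = _≋_ F

  ≋-reflexive : ∀ {p q} → p ≡ q → p ≈ q
  ≋-reflexive refl = ≋-refl

  ⊗-idˡ : ∀ p → con F.1# ⊗ p ≈ p
  ⊗-idˡ p = ≋-trans (⊗-comm _ p) (⊗-idʳ p)

  ⊕-idˡ : ∀ p → con F.0# ⊕ p ≈ p
  ⊕-idˡ p = ≋-trans (⊕-comm _ p) (⊕-idʳ p)

  distribˡ : ∀ p q r → p ⊗ (q ⊕ r) ≈ p ⊗ q ⊕ p ⊗ r
  distribˡ p q r =
    ≋-trans (⊗-comm p _) (≋-trans (distribʳ q r p) (⊕-cong (⊗-comm q p) (⊗-comm r p)))

  -- z = p·0 satisfies z = z + z, hence z = 0 after adding −z.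
  ⊗-zeroʳ : ∀ p → p ⊗ con F.0# ≈ con F.0#
  ⊗-zeroʳ p = ≋-sym (≋-trans (≋-sym (⊕-invʳ z)) (≋-trans (⊕-cong z≈z+z ≋-refl)
                (≋-trans (⊕-assoc z z -z) (≋-trans (⊕-cong ≋-refl (⊕-invʳ z)) (⊕-idʳ z)))))
    where
      z -z : Expr F
      z = p ⊗ con F.0#
      -z = con (F.- F.1#) ⊗ z
      z≈z+z : z ≈ z ⊕ z
      z≈z+z = ≋-trans (⊗-cong ≋-refl (≋-sym (⊕-idʳ (con F.0#)))) (distribˡ p _ _)

  ⊗-zeroˡ : ∀ p → con F.0# ⊗ p ≈ con F.0#
  ⊗-zeroˡ p = ≋-trans (⊗-comm _ p) (⊗-zeroʳ p)

  sum-++ : ∀ xs ys → sumE F (xs ++ ys) ≈ sumE F xs ⊕ sumE F ys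
  sum-++ [] ys = ≋-sym (⊕-idˡ _)
  sum-++ (x ∷ xs) ys = ≋-trans (⊕-cong ≋-refl (sum-++ xs ys)) (≋-sym (⊕-assoc _ _ _))

  prod-++ : ∀ xs ys → prodE F (xs ++ ys) ≈ prodE F xs ⊗ prodE F ys
  prod-++ [] ys = ≋-sym (⊗-idˡ _)
  prod-++ (x ∷ xs) ys = ≋-trans (⊗-cong ≋-refl (prod-++ xs ys)) (≋-sym (⊗-assoc _ _ _))

  prod-ones : ∀ d → prodE F (replicate d (con F.1#)) ≈ con F.1#
  prod-ones zero = ≋-refl
  prod-ones (suc d) = ≋-trans (⊗-cong ≋-refl (prod-ones d)) (⊗-idʳ _)

  sum-cong : ∀ {a} {A : Set a} (f g : A → Expr F) (xs : List A) →
             (∀ x → x ∈ xs → f x ≈ g x) → sumE F (map f xs) ≈ sumE F (map g xs)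
  sum-cong f g [] h = ≋-refl
  sum-cong f g (x ∷ xs) h = ⊕-cong (h x (here refl)) (sum-cong f g xs (λ y y∈ → h y (there y∈)))

  sum-scaleˡ : ∀ {a} {A : Set a} (p : Expr F) (f : A → Expr F) (xs : List A) →
               sumE F (map (λ x → p ⊗ f x) xs) ≈ p ⊗ sumE F (map f xs)
  sum-scaleˡ p f [] = ≋-sym (⊗-zeroʳ p)
  sum-scaleˡ p f (x ∷ xs) = ≋-trans (⊕-cong ≋-refl (sum-scaleˡ p f xs)) (≋-sym (distribˡ _ _ _))

  sum-map-++ : ∀ {a} {A : Set a} (f : A → Expr F) xs ys →
               sumE F (map f (xs ++ ys)) ≈ sumE F (map f xs) ⊕ sumE F (map f ys)
  sum-map-++ f xs ys rewrite map-++ f xs ys = sum-++ (map f xs) (map f ys)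

  sum-cartesian : ∀ {a b} {A : Set a} {B : Set b} (f : A → Expr F) (g : B → Expr F) xs ys →
                  sumE F (map (λ ab → f (proj₁ ab) ⊗ g (proj₂ ab)) (cartesianProduct xs ys))
                    ≈ sumE F (map f xs) ⊗ sumE F (map g ys)
  sum-cartesian f g [] ys = ≋-sym (⊗-zeroˡ _)
  sum-cartesian f g (x ∷ xs) ys =
    ≋-trans (sum-map-++ _ (map (x ,_) ys) (cartesianProduct xs ys))
     (≋-trans (⊕-cong (≋-trans (row ys) (sum-scaleˡ (f x) g ys)) (sum-cartesian f g xs ys))
       (≋-sym (distribʳ _ _ _)))
    where
      row : ∀ zs → sumE F (map (λ ab → f (proj₁ ab) ⊗ g (proj₂ ab)) (map (x ,_) zs))
                    ≈ sumE F (map (λ y → f x ⊗ g y) zs)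
      row [] = ≋-refl
      row (z ∷ zs) = ⊕-cong ≋-refl (row zs)

-- A walk from u is the list
-- of vertices visited after u; we collect its operations and weights and
-- record how the stack machine runs along concatenations of walks.
module LabelledWalks {c ℓ} (F : Field c ℓ) {V : Set} (_≟V_ : DecidableEquality V)
                     (edge : V → V → Maybe (Weight F × StackMachine.Op V)) where

  open import Data.Maybe using (Maybe; just; maybe; _>>=_)
  open import Data.Product using (_×_; proj₁; proj₂)
  open StackMachine
  open import Data.List using (List; []; _∷_; _++_; [_])
  open import Data.List.Properties using (++-assoc)
  open import Relation.Binary.PropositionalEquality hiding ([_])
  open Machine _≟V_ public

  opsOf : V → V → List (Op V)
  opsOf u x = maybe (λ e → [ proj₂ e ]) [] (edge u x)

  weightsOf : V → V → List (Expr F)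
  weightsOf u x = maybe (λ e → [ weightExpr F (proj₁ e) ]) [] (edge u x)

  opsAlong : V → List V → List (Op V)
  opsAlong u [] = []
  opsAlong u (x ∷ ys) = opsOf u x ++ opsAlong x ys

  weightsAlong : V → List V → List (Expr F)
  weightsAlong u [] = []
  weightsAlong u (x ∷ ys) = weightsOf u x ++ weightsAlong x ys

  weightAlong : V → List V → Expr F
  weightAlong u ys = prodE F (weightsAlong u ys)

  endpoint : V → List V → V
  endpoint u [] = u
  endpoint u (x ∷ ys) = endpoint x ys

  data Walk : V → List V → Set c where
    wnil  : ∀ {u} → Walk u []
    wcons : ∀ {u x ys} {e} → edge u x ≡ just e → Walk x ys → Walk u (x ∷ ys)

  endpoint-++ : ∀ u ys zs → endpoint u (ys ++ zs) ≡ endpoint (endpoint u ys) zs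
  endpoint-++ u [] zs = refl
  endpoint-++ u (x ∷ ys) zs = endpoint-++ x ys zs

  opsAlong-++ : ∀ u ys zs → opsAlong u (ys ++ zs) ≡ opsAlong u ys ++ opsAlong (endpoint u ys) zs
  opsAlong-++ u [] zs = refl
  opsAlong-++ u (x ∷ ys) zs rewrite opsAlong-++ x ys zs = sym (++-assoc (opsOf u x) (opsAlong x ys) _)

  weightsAlong-++ : ∀ u ys zs →
                    weightsAlong u (ys ++ zs) ≡ weightsAlong u ys ++ weightsAlong (endpoint u ys) zs
  weightsAlong-++ u [] zs = refl
  weightsAlong-++ u (x ∷ ys) zs rewrite weightsAlong-++ x ys zs =
    sym (++-assoc (weightsOf u x) (weightsAlong x ys) _)

  walk-++ : ∀ {u ys zs} → Walk u ys → Walk (endpoint u ys) zs → Walk u (ys ++ zs)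
  walk-++ wnil w = w
  walk-++ (wcons e w) w′ = wcons e (walk-++ w w′)

  walk-suffix : ∀ {u} ys {zs} → Walk u (ys ++ zs) → Walk (endpoint u ys) zs
  walk-suffix [] w = w
  walk-suffix (x ∷ ys) (wcons e w) = walk-suffix ys w

  opsAlong-∷ : ∀ {u x e} ys → edge u x ≡ just e → opsAlong u (x ∷ ys) ≡ proj₂ e ∷ opsAlong x ys
  opsAlong-∷ ys eq rewrite eq = refl

  weightsAlong-∷ : ∀ {u x e} ys → edge u x ≡ just e →
                   weightsAlong u (x ∷ ys) ≡ weightExpr F (proj₁ e) ∷ weightsAlong x ys
  weightsAlong-∷ ys eq rewrite eq = refl

  run-∷ : ∀ {u x e} ys st → edge u x ≡ just e →
          run (opsAlong u (x ∷ ys)) st ≡ (exec (proj₂ e) st >>= run (opsAlong x ys))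
  run-∷ {u} {x} ys st eq = cong (λ P → run P st) (opsAlong-∷ {u} {x} ys eq)

  run-balanced-prefix : ∀ {u v} a zs st → endpoint u a ≡ v → Balanced (opsAlong u a) →
                        run (opsAlong u (a ++ zs)) st ≡ run (opsAlong v zs) st
  run-balanced-prefix {u} a zs st refl bal
    rewrite opsAlong-++ u a zs | run-++ (opsAlong u a) (opsAlong (endpoint u a) zs) st
          | balanced-run bal st = refl

  opsAlong-through : ∀ {u x e v} a rest → edge u x ≡ just e → endpoint x a ≡ v →
                     opsAlong u (x ∷ a ++ rest) ≡ proj₂ e ∷ (opsAlong x a ++ opsAlong v rest)
  opsAlong-through {u} {x} a rest eq refl = trans (opsAlong-∷ {u} {x} (a ++ rest) eq) (cong (_ ∷_) (opsAlong-++ x a rest))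

  weightsAlong-through : ∀ {u x e v} a rest → edge u x ≡ just e → endpoint x a ≡ v →
                         weightsAlong u (x ∷ a ++ rest) ≡ weightExpr F (proj₁ e) ∷ (weightsAlong x a ++ weightsAlong v rest)
  weightsAlong-through {u} {x} a rest eq refl =
    trans (weightsAlong-∷ {u} {x} (a ++ rest) eq) (cong (_ ∷_) (weightsAlong-++ x a rest))

-- The branching program, first described on the vertex type ℕ × Tag.  Gates
-- are named by their level (the gate added to a circuit of n gates has level
-- n), so that the description does not change when the circuit grows.
-- maxSpan is an upper bound for the lengths of all walks W_k; it bounds the
-- padding chains.
module Construction {c ℓ} (F : Field c ℓ) (maxSpan : ℕ) where

  open import Data.Nat as ℕ using (zero; suc; _+_; _∸_; _<_; _≟_; _<?_; _⊔_; s≤s)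
  import Data.Nat.Properties as ℕP
  open import Data.Fin as Fin using (Fin; toℕ; fromℕ<)
  import Data.Fin.Properties as FinP
  open import Data.List using (List; []; _∷_; _++_; [_]; map; cartesianProduct)
  open import Data.Maybe using (Maybe; just; nothing)
  open import Data.Product using (Σ; _×_; _,_; proj₁)
  open import Data.Product.Properties using (≡-dec)
  open import Data.Empty.Polymorphic using (⊥)
  open import Relation.Nullary using (Dec; yes; no)
  open import Relation.Nullary.Decidable using (map′; _×-dec_)
  open import Relation.Binary.PropositionalEquality hiding ([_])
  open import Relation.Binary.Definitions using (DecidableEquality)
  open StackMachine

  private module F = Field F

  -- Gate k owns the vertices (k , start) = k₋, (k , end) = k₊, (k , mid) and
  -- the padding vertices (k , pad e) of the chain (k , pad e) → … → (k , pad 0) → (k , end).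
  data Tag : Set where
    start end mid : Tag
    pad : ℕ → Tag

  -- tags are numbered; the numbering also serves the final encoding
  tagCode : Tag → ℕ
  tagCode start = 0
  tagCode end = 1
  tagCode mid = 2
  tagCode (pad e) = 3 + e

  tagDecode : ℕ → Tag
  tagDecode 0 = start
  tagDecode 1 = end
  tagDecode 2 = mid
  tagDecode (suc (suc (suc e))) = pad e

  tagDecode-code : ∀ t → tagDecode (tagCode t) ≡ t
  tagDecode-code start = refl
  tagDecode-code end = refl
  tagDecode-code mid = refl
  tagDecode-code (pad e) = refl

  tagCode-decode : ∀ n → tagCode (tagDecode n) ≡ n
  tagCode-decode 0 = refl
  tagCode-decode 1 = refl
  tagCode-decode 2 = refl
  tagCode-decode (suc (suc (suc e))) = refl

  _≟Tag_ : DecidableEquality Tag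
  t ≟Tag t′ = map′ injective (cong tagCode) (tagCode t ≟ tagCode t′)
    where
      injective : tagCode t ≡ tagCode t′ → t ≡ t′
      injective eq = trans (sym (tagDecode-code t)) (trans (cong tagDecode eq) (tagDecode-code t′))

  Vertex : Set
  Vertex = ℕ × Tag

  _≟V_ : DecidableEquality Vertex
  _≟V_ = ≡-dec _≟_ _≟Tag_

  -- A gate uses the tags with codes below tagBound; a vertex is in range for a
  -- circuit of s gates if moreover its gate exists.  Only such vertices receive edges.
  tagBound : ℕ
  tagBound = 4 + maxSpan

  InRange : ℕ → Vertex → Set
  InRange s (k , t) = k < s × tagCode t < tagBound

  inRange? : ∀ s x → Dec (InRange s x)
  inRange? s (k , t) = (k <? s) ×-dec (tagCode t <? tagBound)

  data Kind : Set c where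
    constK : F.Carrier → Kind
    inputK : ℕ → Kind
    timesK plusK : ℕ → ℕ → Kind
    noGate : Kind

  -- the level of the gate with index i (indices count from the newest gate)
  level : ∀ {n} → Fin n → ℕ
  level {n} i = n ∸ suc (toℕ i)

  level< : ∀ {n} (i : Fin n) → level i < n
  level< {suc n} i = s≤s (ℕP.m∸n≤m n (toℕ i))

  level-onto : ∀ {n} k → k < n → Σ (Fin n) λ v → level v ≡ k
  level-onto {suc n} k (s≤s k≤n) = fromℕ< (s≤s (ℕP.m∸n≤m n k)) ,
    trans (cong (n ∸_) (FinP.toℕ-fromℕ< (s≤s (ℕP.m∸n≤m n k)))) (ℕP.m∸[m∸n]≡n k≤n)

  -- A quantity defined gate by gate from the values at the children,
  -- tabulated by level (x₀ at levels without a gate).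
  table : ∀ {a} {X : Set a} → (∀ {n} → Gate F n → (ℕ → X) → X) → X → ∀ {n} → Circuit F n → ℕ → X
  table f x₀ [] k = x₀
  table f x₀ {suc n} (g ∷ C) k = ifDec (k ≟ n) (f g (table f x₀ C)) (table f x₀ C k)

  module _ {a} {X : Set a} (f : ∀ {n} → Gate F n → (ℕ → X) → X) (x₀ : X) {n} (g : Gate F n) (C : Circuit F n) where
    table-top : table f x₀ (g ∷ C) n ≡ f g (table f x₀ C)
    table-top = ifDec-yes (n ≟ n) refl

    table-old : ∀ {k} → k < n → table f x₀ (g ∷ C) k ≡ table f x₀ C k
    table-old k<n = ifDec-no (_ ≟ n) (ℕP.<⇒≢ k<n)

  classify : ∀ {n} → Gate F n → Kind
  classify (const a) = constK a
  classify (input i) = inputK i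
  classify (op times l r) = timesK (level l) (level r)
  classify (op plus l r) = plusK (level l) (level r)

  kindAt : ∀ {n} → Circuit F n → ℕ → Kind
  kindAt = table (λ g _ → classify g) noGate

  polyStep : ∀ {n} → Gate F n → (ℕ → Expr F) → Expr F
  polyStep (const a) f = con a
  polyStep (input i) f = var i
  polyStep (op times l r) f = f (level l) ⊗ f (level r)
  polyStep (op plus l r) f = f (level l) ⊕ f (level r)

  polyAt : ∀ {n} → Circuit F n → ℕ → Expr F
  polyAt = table polyStep (con F.0#)

  -- The plan of gate k: all its walks W_k from (k , start) have length `span`
  -- and end in (exit , end).
  record Plan : Set where
    constructor plan
    field
      span  : ℕ
      exit  : ℕ
      walks : List (List Vertex)
  open Plan public

  padTag : ℕ → Tag
  padTag zero = end
  padTag (suc e) = pad e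

  padHead : ℕ → ℕ → Vertex
  padHead k d = (k , padTag d)

  padChainTail : ℕ → ℕ → List Vertex
  padChainTail k zero = []
  padChainTail k (suc e) = padHead k e ∷ padChainTail k e

  padChain : ℕ → ℕ → List Vertex
  padChain k d = padHead k d ∷ padChainTail k d

  timesWalk : ℕ → ℕ → ℕ → List Vertex × List Vertex → List Vertex
  timesWalk k l r (a , b) = (l , start) ∷ a ++ (k , mid) ∷ (r , start) ∷ b

  timesWalks : ℕ → ℕ → ℕ → List (List Vertex) → List (List Vertex) → List (List Vertex)
  timesWalks k l r A B = map (timesWalk k l r) (cartesianProduct A B)

  branchWalk : ℕ → ℕ → ℕ → List Vertex → List Vertex
  branchWalk k c d a = (c , start) ∷ a ++ padChain k d

  branchWalks : ℕ → ℕ → ℕ → List (List Vertex) → List (List Vertex)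
  branchWalks k c d A = map (branchWalk k c d) A

  plusWalks : ℕ → ℕ → ℕ → ℕ → ℕ → List (List Vertex) → List (List Vertex) → List (List Vertex)
  plusWalks k l r dl dr A B = ifDec (l ≟ r) (branchWalks k l dl A) (branchWalks k l dl A ++ branchWalks k r dr B)

  padding : ℕ → ℕ → ℕ → ℕ
  padding mc ml mr = (ml ⊔ mr) ∸ mc

  planStep : ∀ {n} → Gate F n → (ℕ → Plan) → Plan
  planStep {n} (const a) P = plan 1 n [ [ (n , end) ] ]
  planStep {n} (input i) P = plan 1 n [ [ (n , end) ] ]
  planStep {n} (op times l r) P =
    plan (suc (span (P (level l)) + suc (suc (span (P (level r)))))) (exit (P (level r)))
         (timesWalks n (level l) (level r) (walks (P (level l))) (walks (P (level r))))
  planStep {n} (op plus l r) P =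
    plan (suc (suc (span (P (level l)) ⊔ span (P (level r))))) n
         (plusWalks n (level l) (level r)
                    (padding (span (P (level l))) (span (P (level l))) (span (P (level r))))
                    (padding (span (P (level r))) (span (P (level l))) (span (P (level r))))
                    (walks (P (level l))) (walks (P (level r))))

  planAt : ∀ {n} → Circuit F n → ℕ → Plan
  planAt = table planStep (plan 0 0 [])

  one two : Weight F
  one = cst F.1#
  two = cst (F.1# F.+ F.1#)

  Label : Set c
  Label = Weight F × Op Vertex

  -- A gate's start vertex has the
  -- edges described above; (u , end) has a pop edge to y whenever y is a return
  -- vertex waiting for the exit u; each padding vertex has a nop edge to the
  -- next one.
  module Graph {s} (C : Circuit F s) where
    kindOf : ℕ → Kind
    kindOf = kindAt C

    spanOf exitOf : ℕ → ℕ
    spanOf k = span (planAt C k)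
    exitOf k = exit (planAt C k)

    walksOf : ℕ → List (List Vertex)
    walksOf k = walks (planAt C k)

    padˡ padʳ : ℕ → ℕ → ℕ
    padˡ l r = padding (spanOf l) (spanOf l) (spanOf r)
    padʳ l r = padding (spanOf r) (spanOf l) (spanOf r)

    startEdge : ℕ → Kind → Vertex → Maybe Label
    startEdge k (constK a) y = ifDec (y ≟V (k , end)) (just (cst a , noop)) nothing
    startEdge k (inputK i) y = ifDec (y ≟V (k , end)) (just (X i , noop)) nothing
    startEdge k (timesK l r) y = ifDec (y ≟V (l , start)) (just (one , push↑ (k , mid))) nothing
    startEdge k (plusK l r) y = ifDec (l ≟ r)
      (ifDec (y ≟V (l , start)) (just (two , push↑ (padHead k (padˡ l r)))) nothing)
      (ifDec (y ≟V (l , start)) (just (one , push↑ (padHead k (padˡ l r))))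
        (ifDec (y ≟V (r , start)) (just (one , push↑ (padHead k (padʳ l r)))) nothing))
    startEdge k noGate y = nothing

    midEdge : ℕ → Kind → Vertex → Maybe Label
    midEdge k (timesK l r) y = ifDec (y ≟V (r , start)) (just (one , noop)) nothing
    midEdge k _ y = nothing

    padEdge : ℕ → Tag → Maybe Label
    padEdge zero end = just (one , noop)
    padEdge (suc e) (pad e′) = ifDec (e ≟ e′) (just (one , noop)) nothing
    padEdge _ _ = nothing

    -- (return vertex , exit it waits for)
    returnEdges : ℕ → Kind → List (Vertex × Vertex)
    returnEdges k (timesK l r) = [ ((k , mid) , (exitOf l , end)) ]
    returnEdges k (plusK l r) =
      (padHead k (padˡ l r) , (exitOf l , end)) ∷ (padHead k (padʳ l r) , (exitOf r , end)) ∷ []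
    returnEdges k _ = []

    open import Data.List.Membership.DecPropositional (≡-dec _≟V_ _≟V_) using (_∈?_)

    edge₀ : Vertex → Vertex → Maybe Label
    edge₀ (k , start) y = startEdge k (kindOf k) y
    edge₀ (k , mid) y = midEdge k (kindOf k) y
    edge₀ (k , pad e) (k′ , t) = ifDec (k ≟ k′) (padEdge e t) nothing
    edge₀ (k , end) y =
      ifDec ((y , (k , end)) ∈? returnEdges (proj₁ y) (kindOf (proj₁ y))) (just (one , pop↓ y)) nothing

    edge : Vertex → Vertex → Maybe Label
    edge x y = ifDec (inRange? s y) (edge₀ x y) nothing

  Unfolds : ∀ {n} → Circuit F n → ℕ → Kind → Set c
  Unfolds C k (constK a) = planAt C k ≡ plan 1 k [ [ (k , end) ] ] × polyAt C k ≡ con a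
  Unfolds C k (inputK i) = planAt C k ≡ plan 1 k [ [ (k , end) ] ] × polyAt C k ≡ var i
  Unfolds C k (timesK l r) = l < k × r < k ×
    planAt C k ≡ plan (suc (span (planAt C l) + suc (suc (span (planAt C r))))) (exit (planAt C r))
                      (timesWalks k l r (walks (planAt C l)) (walks (planAt C r))) ×
    polyAt C k ≡ polyAt C l ⊗ polyAt C r
  Unfolds C k (plusK l r) = l < k × r < k ×
    planAt C k ≡ plan (suc (suc (span (planAt C l) ⊔ span (planAt C r)))) k
         (plusWalks k l r (padding (span (planAt C l)) (span (planAt C l)) (span (planAt C r)))
                          (padding (span (planAt C r)) (span (planAt C l)) (span (planAt C r)))
                    (walks (planAt C l)) (walks (planAt C r))) ×
    polyAt C k ≡ polyAt C l ⊕ polyAt C r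
  Unfolds C k noGate = ⊥

  module _ {n} (g : Gate F n) (C : Circuit F n) where
    planAt-top : planAt (g ∷ C) n ≡ planStep g (planAt C)
    planAt-top = table-top planStep (plan 0 0 []) g C
    polyAt-top : polyAt (g ∷ C) n ≡ polyStep g (polyAt C)
    polyAt-top = table-top polyStep (con F.0#) g C
    planAt-old : ∀ {k} → k < n → planAt (g ∷ C) k ≡ planAt C k
    planAt-old = table-old planStep (plan 0 0 []) g C
    polyAt-old : ∀ {k} → k < n → polyAt (g ∷ C) k ≡ polyAt C k
    polyAt-old = table-old polyStep (con F.0#) g C

    unfolds-old : ∀ {k} K → k < n → Unfolds C k K → Unfolds (g ∷ C) k K
    unfolds-old (constK a) p (e1 , e2) rewrite planAt-old p | polyAt-old p = e1 , e2
    unfolds-old (inputK i) p (e1 , e2) rewrite planAt-old p | polyAt-old p = e1 , e2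
    unfolds-old (timesK l r) p (l< , r< , e1 , e2)
      rewrite planAt-old p | polyAt-old p | planAt-old (ℕP.<-trans l< p) | polyAt-old (ℕP.<-trans l< p)
            | planAt-old (ℕP.<-trans r< p) | polyAt-old (ℕP.<-trans r< p) = l< , r< , e1 , e2
    unfolds-old (plusK l r) p (l< , r< , e1 , e2)
      rewrite planAt-old p | polyAt-old p | planAt-old (ℕP.<-trans l< p) | polyAt-old (ℕP.<-trans l< p)
            | planAt-old (ℕP.<-trans r< p) | polyAt-old (ℕP.<-trans r< p) = l< , r< , e1 , e2
    unfolds-old noGate p ()

  unfolds-top : ∀ {n} (g : Gate F n) (C : Circuit F n) → Unfolds (g ∷ C) n (classify g)
  unfolds-top g@(const a) C rewrite planAt-top g C | polyAt-top g C = refl , refl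
  unfolds-top g@(input i) C rewrite planAt-top g C | polyAt-top g C = refl , refl
  unfolds-top g@(op times l r) C
    rewrite planAt-top g C | polyAt-top g C | planAt-old g C (level< l) | polyAt-old g C (level< l)
          | planAt-old g C (level< r) | polyAt-old g C (level< r) = level< l , level< r , refl , refl
  unfolds-top g@(op plus l r) C
    rewrite planAt-top g C | polyAt-top g C | planAt-old g C (level< l) | polyAt-old g C (level< l)
          | planAt-old g C (level< r) | polyAt-old g C (level< r) = level< l , level< r , refl , refl

  unfolds : ∀ {n} (C : Circuit F n) k → k < n → Unfolds C k (kindAt C k)
  unfolds {suc n} (g ∷ C) k k<1+n with k ≟ n
  ... | yes refl = unfolds-top g C
  ... | no k≢n = unfolds-old g C (kindAt C k) k<n (unfolds C k k<n)
    where
      k<n : k < n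
      k<n = ℕP.≤∧≢⇒< (ℕP.≤-pred k<1+n) k≢n

  polyAt-level : ∀ {n} (C : Circuit F n) (v : Fin n) → polyAt C (level v) ≡ poly F C v
  polyAt-level (g@(const a) ∷ C) Fin.zero = polyAt-top g C
  polyAt-level (g@(input i) ∷ C) Fin.zero = polyAt-top g C
  polyAt-level (g@(op plus l r) ∷ C) Fin.zero = trans (polyAt-top g C) (cong₂ _⊕_ (polyAt-level C l) (polyAt-level C r))
  polyAt-level (g@(op times l r) ∷ C) Fin.zero = trans (polyAt-top g C) (cong₂ _⊗_ (polyAt-level C l) (polyAt-level C r))
  polyAt-level (g@(const _) ∷ C) (Fin.suc v) = trans (polyAt-old g C (level< v)) (polyAt-level C v)
  polyAt-level (g@(input _) ∷ C) (Fin.suc v) = trans (polyAt-old g C (level< v)) (polyAt-level C v)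
  polyAt-level (g@(op plus _ _) ∷ C) (Fin.suc v) = trans (polyAt-old g C (level< v)) (polyAt-level C v)
  polyAt-level (g@(op times _ _) ∷ C) (Fin.suc v) = trans (polyAt-old g C (level< v)) (polyAt-level C v)

-- The walks of gate v have length less than 2|C_v|: a ×-gate adds three
-- edges to the walks of its children, whose subcircuits are disjoint by
-- multiplicative disjointness; a +-gate adds two edges to the longer one.
module SpanBound {c ℓ} (F : Field c ℓ) (maxSpan : ℕ) where

  open import Data.Nat using (zero; suc; _+_; _*_; _≤_; _⊔_)
  import Data.Nat.Properties as ℕP
  open import Data.Fin using (Fin)
  open import Data.Fin.Subset using (Subset; _∪_; _∩_; ∣_∣; inside; outside)
  open import Data.Fin.Subset.Properties using (∣⊥∣≡0; ∣⁅x⁆∣≡1; ∣p∣⊔∣q∣≤∣p∪q∣)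
  open import Data.Vec using (_∷_; [])
  open import Data.Product using (_,_; proj₂)
  open import Relation.Binary.PropositionalEquality
  open Construction F maxSpan

  ∣p∪q∣+∣p∩q∣ : ∀ {n} (p q : Subset n) → ∣ p ∪ q ∣ + ∣ p ∩ q ∣ ≡ ∣ p ∣ + ∣ q ∣
  ∣p∪q∣+∣p∩q∣ [] [] = refl
  ∣p∪q∣+∣p∩q∣ (inside ∷ p) (inside ∷ q) rewrite ℕP.+-suc ∣ p ∪ q ∣ ∣ p ∩ q ∣ | ℕP.+-suc ∣ p ∣ ∣ q ∣ =
    cong (λ z → suc (suc z)) (∣p∪q∣+∣p∩q∣ p q)
  ∣p∪q∣+∣p∩q∣ (inside ∷ p) (outside ∷ q) = cong suc (∣p∪q∣+∣p∩q∣ p q)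
  ∣p∪q∣+∣p∩q∣ (outside ∷ p) (inside ∷ q) rewrite ℕP.+-suc ∣ p ∣ ∣ q ∣ = cong suc (∣p∪q∣+∣p∩q∣ p q)
  ∣p∪q∣+∣p∩q∣ (outside ∷ p) (outside ∷ q) = ∣p∪q∣+∣p∩q∣ p q

  ∣p∪q∣-disjoint : ∀ {n} (p q : Subset n) → p ∩ q ≡ Data.Fin.Subset.⊥ → ∣ p ∪ q ∣ ≡ ∣ p ∣ + ∣ q ∣
  ∣p∪q∣-disjoint {n} p q disjoint = begin
    ∣ p ∪ q ∣                ≡⟨ sym (ℕP.+-identityʳ _) ⟩
    ∣ p ∪ q ∣ + 0            ≡⟨ cong (λ z → ∣ p ∪ q ∣ + z) (sym (trans (cong ∣_∣ disjoint) (∣⊥∣≡0 n))) ⟩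
    ∣ p ∪ q ∣ + ∣ p ∩ q ∣    ≡⟨ ∣p∪q∣+∣p∩q∣ p q ⟩
    ∣ p ∣ + ∣ q ∣            ∎
    where open ≡-Reasoning

  span-bound : ∀ {n} (C : Circuit F n) → MultDisjoint F C → ∀ (v : Fin n) →
               suc (span (planAt C (level v))) ≤ 2 * ∣ subGates F C v ∣
  span-bound {suc n} (const a ∷ C) md Fin.zero rewrite planAt-top (const a) C =
    ℕP.≤-reflexive (cong (2 *_) (sym (∣⁅x⁆∣≡1 {n = suc n} Fin.zero)))
  span-bound {suc n} (input i ∷ C) md Fin.zero rewrite planAt-top (input i) C =
    ℕP.≤-reflexive (cong (2 *_) (sym (∣⁅x⁆∣≡1 {n = suc n} Fin.zero)))
  span-bound (op times l r ∷ C) (disjoint , md) Fin.zero rewrite planAt-top (op times l r) C = begin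
    suc (suc (ml + suc (suc mr)))  ≡⟨ cong (λ z → suc (suc z)) (ℕP.+-suc ml (suc mr)) ⟩
    2 + (suc ml + suc mr)          ≤⟨ ℕP.+-monoʳ-≤ 2 (ℕP.+-mono-≤ (span-bound C md l) (span-bound C md r)) ⟩
    2 + (2 * sl + 2 * sr)          ≡⟨ cong (2 +_) (sym (ℕP.*-distribˡ-+ 2 sl sr)) ⟩
    2 + 2 * (sl + sr)              ≡⟨ sym (ℕP.*-distribˡ-+ 2 1 (sl + sr)) ⟩
    2 * suc (sl + sr)              ≡⟨ cong (λ z → 2 * suc z) (sym (∣p∪q∣-disjoint _ _ disjoint)) ⟩
    2 * ∣ subGates F (op times l r ∷ C) Fin.zero ∣ ∎
    where
      open ℕP.≤-Reasoning
      ml mr sl sr : ℕ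
      ml = span (planAt C (level l)) ; mr = span (planAt C (level r))
      sl = ∣ subGates F C l ∣ ; sr = ∣ subGates F C r ∣
  span-bound (op plus l r ∷ C) md Fin.zero rewrite planAt-top (op plus l r) C = begin
    2 + suc (ml ⊔ mr)              ≤⟨ ℕP.+-monoʳ-≤ 2 (ℕP.⊔-mono-≤ (span-bound C md l) (span-bound C md r)) ⟩
    2 + (2 * sl ⊔ 2 * sr)          ≡⟨ cong (2 +_) (sym (ℕP.*-distribˡ-⊔ 2 sl sr)) ⟩
    2 + 2 * (sl ⊔ sr)              ≤⟨ ℕP.+-monoʳ-≤ 2 (ℕP.*-monoʳ-≤ 2 (∣p∣⊔∣q∣≤∣p∪q∣ (subGates F C l) (subGates F C r))) ⟩
    2 + 2 * su                     ≡⟨ sym (ℕP.*-distribˡ-+ 2 1 su) ⟩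
    2 * suc su                     ∎
    where
      open ℕP.≤-Reasoning
      ml mr sl sr su : ℕ
      ml = span (planAt C (level l)) ; mr = span (planAt C (level r))
      sl = ∣ subGates F C l ∣ ; sr = ∣ subGates F C r ∣
      su = ∣ subGates F C l ∪ subGates F C r ∣
  span-bound (g@(const _) ∷ C) md (Fin.suc v) rewrite planAt-old g C (level< v) = span-bound C md v
  span-bound (g@(input _) ∷ C) md (Fin.suc v) rewrite planAt-old g C (level< v) = span-bound C md v
  span-bound (g@(op plus _ _) ∷ C) md (Fin.suc v) rewrite planAt-old g C (level< v) = span-bound C md v
  span-bound (g@(op times _ _) ∷ C) md (Fin.suc v) rewrite planAt-old g C (level< v) = span-bound C (proj₂ md) v

module Invariant {c ℓ} (F : Field c ℓ) (maxSpan : ℕ) {s} (C : Circuit F s) where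

  open import Level using (_⊔_)
  open import Data.Nat using (zero; suc; _<_; _≤_; _≟_; s≤s; z≤n)
  open import Data.Nat.Properties using (≤-pred; m≤n⇒m≤1+n)
  open import Data.List using (List; []; _∷_; _++_; [_]; map; length; replicate)
  open import Data.List.Membership.Propositional using (_∈_)
  open import Data.List.Relation.Unary.Any using (here)
  open import Data.List.Relation.Unary.Unique.Propositional using (Unique)
  open import Data.List.Relation.Unary.AllPairs using ([]; _∷_)
  open import Data.List.Relation.Unary.All using ([])
  open import Data.Maybe using (just; nothing)
  open import Data.Maybe.Properties using (just-injective)
  open import Data.Product using (Σ; _×_; _,_; proj₁; proj₂)
  open import Data.Product.Properties using (≡-dec)
  open import Data.Sum using (_⊎_; inj₁; inj₂)
  open import Relation.Nullary using (yes; no)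
  open import Data.Empty using (⊥-elim)
  open import Relation.Binary.PropositionalEquality hiding ([_])
  open StackMachine
  open Construction F maxSpan public
  open Graph C public
  open LabelledWalks F _≟V_ edge public
  open PolyAlgebra F using (_≈_; ≋-reflexive)
  open import Data.List.Membership.DecPropositional (≡-dec _≟V_ _≟V_) using (_∈?_)

  private module F = Field F

  start-in : ∀ {k} → k < s → InRange s (k , start)
  start-in k<s = k<s , s≤s z≤n

  end-in : ∀ {k} → k < s → InRange s (k , end)
  end-in k<s = k<s , s≤s (s≤s z≤n)

  mid-in : ∀ {k} → k < s → InRange s (k , mid)
  mid-in k<s = k<s , s≤s (s≤s (s≤s z≤n))

  edge-inv : ∀ {x y e} → edge x y ≡ just e → edge₀ x y ≡ just e × InRange s y
  edge-inv {x} {y} eq with inRange? s y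
  ... | yes y-in = eq , y-in

  edge-intro : ∀ {x y e} → InRange s y → edge₀ x y ≡ just e → edge x y ≡ just e
  edge-intro {x} {y} y-in eq rewrite ifDec-yes (inRange? s y) {edge₀ x y} {nothing} y-in = eq

  endEdge-inv : ∀ {u y e} → edge (u , end) y ≡ just e → e ≡ (one , pop↓ y)
  endEdge-inv {u} {y} eq =
    sym (proj₂ (ifDec-just ((y , (u , end)) ∈? returnEdges (proj₁ y) (kindOf (proj₁ y)))
                           (proj₁ (edge-inv {u , end} {y} eq))))

  module _ (x : Vertex) {a : Vertex} {z : Label} (out : ∀ y → edge₀ x y ≡ ifDec (y ≟V a) (just z) nothing) where
    single-only : ∀ y e → edge x y ≡ just e → y ≡ a × e ≡ z
    single-only y e eq with ifDec-just (y ≟V a) (trans (sym (out y)) (proj₁ (edge-inv {x} {y} eq)))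
    ... | y≡a , z≡e = y≡a , sym z≡e

    single-edge : InRange s a → edge x a ≡ just z
    single-edge a-in = edge-intro {x} {a} a-in (trans (out a) (ifDec-yes (a ≟V a) refl))

  return-edge : ∀ {u y} → InRange s y → (y , (u , end)) ∈ returnEdges (proj₁ y) (kindOf (proj₁ y)) →
                edge (u , end) y ≡ just (one , pop↓ y)
  return-edge {u} {y} y-in waiting =
    edge-intro {u , end} {y} y-in (ifDec-yes ((y , (u , end)) ∈? returnEdges (proj₁ y) (kindOf (proj₁ y))) waiting)

  pop-step : ∀ {u x e zs Y st} → edge (u , end) x ≡ just e →
             run (opsAlong (u , end) (x ∷ zs)) (Y ∷ st) ≢ nothing →
             x ≡ Y × run (opsAlong (u , end) (x ∷ zs)) (Y ∷ st) ≡ run (opsAlong x zs) st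
  pop-step {u} {x} {e} {zs} {Y} {st} eq ok with endEdge-inv {u} {x} eq
  ... | refl with x ≟V Y | run-∷ {u , end} {x} zs (Y ∷ st) eq
  ...   | yes refl | run≡ = refl , run≡
  ...   | no _     | run≡ = ⊥-elim (ok run≡)

  padHead-inRange : ∀ {k d} → k < s → d ≤ suc maxSpan → InRange s (padHead k d)
  padHead-inRange {d = zero} k<s d≤ = k<s , s≤s (s≤s z≤n)
  padHead-inRange {d = suc e} k<s d≤ = k<s , s≤s (s≤s (s≤s d≤))

  padChain-edge : ∀ {k e} → k < s → suc e ≤ suc maxSpan →
                  edge (padHead k (suc e)) (padHead k e) ≡ just (one , noop)
  padChain-edge {k} {e} k<s d≤ =
    edge-intro {padHead k (suc e)} {padHead k e} (padHead-inRange k<s (m≤n⇒m≤1+n (≤-pred d≤)))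
               (trans (ifDec-yes (k ≟ k) refl) (next e))
    where
      next : ∀ e → padEdge e (padTag e) ≡ just (one , noop)
      next zero = refl
      next (suc e) = ifDec-yes (e ≟ e) refl

  padChain-edge-inv : ∀ {k e y x} → edge (padHead k (suc e)) y ≡ just x →
                      y ≡ padHead k e × x ≡ (one , noop)
  padChain-edge-inv {k} {e} {k′ , t} eq with k ≟ k′ | proj₁ (edge-inv {padHead k (suc e)} {k′ , t} eq)
  ... | yes refl | eq′ = next e t eq′
    where
      next : ∀ e t {x} → padEdge e t ≡ just x → (k , t) ≡ padHead k e × x ≡ (one , noop)
      next zero end refl = refl , refl
      next (suc e) (pad e′) eq with e ≟ e′
      ... | yes refl = refl , sym (just-injective eq)

  padChain-walk : ∀ {k} d → k < s → d ≤ suc maxSpan → Walk (padHead k d) (padChainTail k d)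
  padChain-walk zero k<s d≤ = wnil
  padChain-walk (suc e) k<s d≤ =
    wcons (padChain-edge k<s d≤) (padChain-walk e k<s (m≤n⇒m≤1+n (≤-pred d≤)))

  padChain-endpoint : ∀ k d → endpoint (padHead k d) (padChainTail k d) ≡ (k , end)
  padChain-endpoint k zero = refl
  padChain-endpoint k (suc e) = padChain-endpoint k e

  padChain-length : ∀ k d → length (padChainTail k d) ≡ d
  padChain-length k zero = refl
  padChain-length k (suc e) = cong suc (padChain-length k e)

  padChain-ops : ∀ {k} d → k < s → d ≤ suc maxSpan →
                 opsAlong (padHead k d) (padChainTail k d) ≡ replicate d noop
  padChain-ops zero k<s d≤ = refl
  padChain-ops {k} (suc e) k<s d≤ =
    trans (opsAlong-∷ {padHead k (suc e)} {padHead k e} (padChainTail k e) (padChain-edge k<s d≤))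
          (cong (noop ∷_) (padChain-ops e k<s (m≤n⇒m≤1+n (≤-pred d≤))))

  padChain-weights : ∀ {k} d → k < s → d ≤ suc maxSpan →
                     weightsAlong (padHead k d) (padChainTail k d) ≡ replicate d (con F.1#)
  padChain-weights zero k<s d≤ = refl
  padChain-weights {k} (suc e) k<s d≤ =
    trans (weightsAlong-∷ {padHead k (suc e)} {padHead k e} (padChainTail k e) (padChain-edge k<s d≤))
          (cong (con F.1# ∷_) (padChain-weights e k<s (m≤n⇒m≤1+n (≤-pred d≤))))

  padChain-parse : ∀ {k} d zs → Walk (padHead k d) zs →
    (endpoint (padHead k d) zs ≢ (k , end) × (∀ st → run (opsAlong (padHead k d) zs) st ≡ just st))
    ⊎ Σ (List Vertex) λ zs′ → zs ≡ padChainTail k d ++ zs′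
  padChain-parse zero zs w = inj₂ (zs , refl)
  padChain-parse (suc e) [] w = inj₁ ((λ ()) , λ st → refl)
  padChain-parse {k} (suc e) (x ∷ zs) (wcons eq w) with padChain-edge-inv {k} {e} {x} eq
  ... | refl , refl with padChain-parse e zs w
  ...   | inj₁ (ne , run≡) = inj₁ (ne , λ st → trans (run-∷ {padHead k (suc e)} {padHead k e} zs st eq) (run≡ st))
  ...   | inj₂ (zs′ , refl) = inj₂ (zs′ , refl)

  data Parse (k : ℕ) (P : Plan) (ys st : List Vertex) : Set where
    incomplete : ∀ σ → run (opsAlong (k , start) ys) st ≡ just (σ ++ st) →
                 endpoint (k , start) ys ≢ (exit P , end) ⊎ σ ≢ [] → Parse k P ys st
    extends : ∀ {w} zs → w ∈ walks P → ys ≡ w ++ zs → Parse k P ys st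

  record GateSpec (k : ℕ) (P : Plan) (f : Expr F) : Set (c ⊔ ℓ) where
    field
      isWalk     : ∀ w → w ∈ walks P → Walk (k , start) w
      endsAtExit : ∀ w → w ∈ walks P → endpoint (k , start) w ≡ (exit P , end)
      hasSpan    : ∀ w → w ∈ walks P → length w ≡ span P
      balanced   : ∀ w → w ∈ walks P → Balanced (opsAlong (k , start) w)
      unique     : Unique (walks P)
      exit<s     : exit P < s
      weightSum  : sumE F (map (weightAlong (k , start)) (walks P)) ≈ f
      parse      : ∀ ys st → Walk (k , start) ys → run (opsAlong (k , start) ys) st ≢ nothing →
                   Parse k P ys st

  Spec : ℕ → Set (c ⊔ ℓ)
  Spec k = GateSpec k (planAt C k) (polyAt C k)

  parse-widen : ∀ {k P P′ ys st} → exit P ≡ exit P′ → (∀ {w} → w ∈ walks P → w ∈ walks P′) →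
                Parse k P ys st → Parse k P′ ys st
  parse-widen same f (incomplete σ run≡ (inj₁ ne)) =
    incomplete σ run≡ (inj₁ λ e → ne (trans e (cong (_, end) (sym same))))
  parse-widen same f (incomplete σ run≡ (inj₂ ne)) = incomplete σ run≡ (inj₂ ne)
  parse-widen same f (extends zs w∈ eq) = extends zs (f w∈) eq

  leafSpec : ∀ k (wgt : Weight F) → k < s →
    (∀ y e → edge (k , start) y ≡ just e → y ≡ (k , end) × e ≡ (wgt , noop)) →
    edge (k , start) (k , end) ≡ just (wgt , noop) →
    GateSpec k (plan 1 k [ [ (k , end) ] ]) (weightExpr F wgt)
  leafSpec k wgt k<s only-edge the-edge = record
    { isWalk     = λ { _ (here refl) → wcons the-edge wnil }
    ; endsAtExit = λ { _ (here refl) → refl }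
    ; hasSpan    = λ { _ (here refl) → refl }
    ; balanced   = λ { _ (here refl) →
                       subst Balanced (sym (opsAlong-∷ {k , start} {k , end} [] the-edge)) (nopˡ empty) }
    ; unique     = [] ∷ []
    ; exit<s     = k<s
    ; weightSum  = ≋-trans (⊕-idʳ _) (≋-trans (≋-reflexive (cong (prodE F) weights)) (⊗-idʳ _))
    ; parse      = leafParse
    }
    where
      weights : weightsAlong (k , start) [ (k , end) ] ≡ [ weightExpr F wgt ]
      weights = weightsAlong-∷ {k , start} {k , end} [] the-edge
      leafParse : ∀ ys st → Walk (k , start) ys → run (opsAlong (k , start) ys) st ≢ nothing →
                  Parse k (plan 1 k [ [ (k , end) ] ]) ys st
      leafParse [] st w _ = incomplete [] refl (inj₁ λ ())
      leafParse (x ∷ ys) st (wcons eq w) _ with only-edge x _ eq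
      ... | refl , _ = extends ys (here refl) refl

-- Its walks are
--   k₋ → (l , start) ⋯ (exitOf l , end) → (k , mid) → (r , start) ⋯ (exitOf r , end),
-- one for each pair of walks of l and r, with operations
-- push (k , mid) · ops(a) · pop (k , mid) · nop · ops(b) and weight wt(a) · wt(b).
module TimesGate {c ℓ} (F : Field c ℓ) (maxSpan : ℕ) {s} (C : Circuit F s) where

  open import Data.Nat using (suc; _+_)
  open import Data.List using (List; []; _∷_; _++_; [_]; map; cartesianProduct; length; take; drop)
  open import Data.List.Properties using (++-assoc; length-++; map-∘; map-id-local; ++-conicalʳ)
  open import Data.List.Membership.Propositional using (_∈_)
  open import Data.List.Membership.Propositional.Properties
    using (∈-map⁻; ∈-map⁺; ∈-cartesianProduct⁻; ∈-cartesianProduct⁺)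
  open import Data.List.Relation.Unary.All as All using ()
  open import Data.List.Relation.Unary.Unique.Propositional using (Unique)
  import Data.List.Relation.Unary.Unique.Propositional.Properties as Unique
  open import Data.Maybe using (just; nothing)
  open import Data.Product using (_×_; _,_; proj₁; proj₂)
  open import Function using (case_of_)
  open import Data.Sum using (inj₁; inj₂; map₁)
  open import Relation.Binary.PropositionalEquality hiding ([_])
  open StackMachine
  open Invariant F maxSpan C
  open PolyAlgebra F using (_≈_; ≋-reflexive; prod-++; ⊗-idˡ; sum-cong; sum-cartesian)

  private module F = Field F

  take-length-++ : ∀ {A : Set} (a z : List A) → take (length a) (a ++ z) ≡ a
  take-length-++ [] z = refl
  take-length-++ (x ∷ a) z = cong (x ∷_) (take-length-++ a z)

  drop-length-++ : ∀ {A : Set} (a z : List A) → drop (length a) (a ++ z) ≡ z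
  drop-length-++ [] z = refl
  drop-length-++ (x ∷ a) z = drop-length-++ a z

  module _ (k l r : ℕ)
    (enter-only  : ∀ y e → edge (k , start) y ≡ just e → y ≡ (l , start) × e ≡ (one , push↑ (k , mid)))
    (enterEdge   : edge (k , start) (l , start) ≡ just (one , push↑ (k , mid)))
    (returnEdge  : edge (exitOf l , end) (k , mid) ≡ just (one , pop↓ (k , mid)))
    (resume-only : ∀ y e → edge (k , mid) y ≡ just e → y ≡ (r , start) × e ≡ (one , noop))
    (resumeEdge  : edge (k , mid) (r , start) ≡ just (one , noop))
    (Sl : Spec l) (Sr : Spec r) where

    private
      module Sl = GateSpec Sl
      module Sr = GateSpec Sr
      A B : List (List Vertex)
      A = walksOf l
      B = walksOf r
      walk : List Vertex × List Vertex → List Vertex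
      walk = timesWalk k l r

    timesPlan : Plan
    timesPlan = plan (suc (spanOf l + suc (suc (spanOf r)))) (exitOf r) (timesWalks k l r A B)

    tailOps : ∀ b → opsAlong (exitOf l , end) ((k , mid) ∷ (r , start) ∷ b) ≡ pop↓ (k , mid) ∷ noop ∷ opsAlong (r , start) b
    tailOps b = trans (opsAlong-∷ {exitOf l , end} {k , mid} ((r , start) ∷ b) returnEdge)
                      (cong (pop↓ (k , mid) ∷_) (opsAlong-∷ {k , mid} {r , start} b resumeEdge))

    tailWeights : ∀ b → weightsAlong (exitOf l , end) ((k , mid) ∷ (r , start) ∷ b)
                        ≡ con F.1# ∷ con F.1# ∷ weightsAlong (r , start) b
    tailWeights b = trans (weightsAlong-∷ {exitOf l , end} {k , mid} ((r , start) ∷ b) returnEdge)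
                          (cong (con F.1# ∷_) (weightsAlong-∷ {k , mid} {r , start} b resumeEdge))

    walk-ops : ∀ a b → a ∈ A → opsAlong (k , start) (walk (a , b))
               ≡ push↑ (k , mid) ∷ (opsAlong (l , start) a ++ pop↓ (k , mid) ∷ noop ∷ opsAlong (r , start) b)
    walk-ops a b a∈ = trans (opsAlong-through {k , start} {l , start} a _ enterEdge (Sl.endsAtExit a a∈))
                            (cong (λ P → push↑ (k , mid) ∷ (opsAlong (l , start) a ++ P)) (tailOps b))

    walk-weights : ∀ a b → a ∈ A → weightsAlong (k , start) (walk (a , b))
                   ≡ con F.1# ∷ (weightsAlong (l , start) a ++ con F.1# ∷ con F.1# ∷ weightsAlong (r , start) b)
    walk-weights a b a∈ = trans (weightsAlong-through {k , start} {l , start} a _ enterEdge (Sl.endsAtExit a a∈))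
                                (cong (λ ws → con F.1# ∷ (weightsAlong (l , start) a ++ ws)) (tailWeights b))

    walk-weight : ∀ a b → a ∈ A →
                  weightAlong (k , start) (walk (a , b)) ≈ weightAlong (l , start) a ⊗ weightAlong (r , start) b
    walk-weight a b a∈ rewrite walk-weights a b a∈ =
      ≋-trans (⊗-idˡ _) (≋-trans (prod-++ (weightsAlong (l , start) a) _)
        (⊗-cong ≋-refl (≋-trans (⊗-idˡ _) (⊗-idˡ _))))

    walk-isWalk : ∀ {a b} → a ∈ A → b ∈ B → Walk (k , start) (walk (a , b))
    walk-isWalk {a} {b} a∈ b∈ =
      wcons enterEdge (walk-++ (Sl.isWalk a a∈)
        (subst (λ u → Walk u ((k , mid) ∷ (r , start) ∷ b)) (sym (Sl.endsAtExit a a∈))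
           (wcons returnEdge (wcons resumeEdge (Sr.isWalk b b∈)))))

    walk-endpoint : ∀ {a b} → a ∈ A → b ∈ B → endpoint (k , start) (walk (a , b)) ≡ (exitOf r , end)
    walk-endpoint {a} {b} a∈ b∈ =
      trans (endpoint-++ (l , start) a _)
        (trans (cong (λ v → endpoint v ((k , mid) ∷ (r , start) ∷ b)) (Sl.endsAtExit a a∈)) (Sr.endsAtExit b b∈))

    walk-length : ∀ {a b} → a ∈ A → b ∈ B → length (walk (a , b)) ≡ span timesPlan
    walk-length {a} {b} a∈ b∈ =
      cong suc (trans (length-++ a) (cong₂ (λ x y → x + suc (suc y)) (Sl.hasSpan a a∈) (Sr.hasSpan b b∈)))

    walk-balanced : ∀ {a b} → a ∈ A → b ∈ B → Balanced (opsAlong (k , start) (walk (a , b)))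
    walk-balanced {a} {b} a∈ b∈ =
      subst Balanced (sym (walk-ops a b a∈))
        (subst Balanced (++-assoc (push↑ (k , mid) ∷ opsAlong (l , start) a) [ pop↓ (k , mid) ] _)
          (cat (wrap (k , mid) (Sl.balanced a a∈)) (nopˡ (Sr.balanced b b∈))))

    -- walk is injective on A × B since the walks of l have a common length
    split : List Vertex → List Vertex × List Vertex
    split w = take (spanOf l) (drop 1 w) , drop 2 (drop (spanOf l) (drop 1 w))

    split-walk : ∀ a b → a ∈ A → split (walk (a , b)) ≡ (a , b)
    split-walk a b a∈ rewrite sym (Sl.hasSpan a a∈) | take-length-++ a ((k , mid) ∷ (r , start) ∷ b)
      | drop-length-++ a ((k , mid) ∷ (r , start) ∷ b) = refl

    walks-unique : Unique (timesWalks k l r A B)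
    walks-unique = Unique.map⁻ {f = split} (subst Unique (sym split∘walk≡id) (Unique.cartesianProduct⁺ Sl.unique Sr.unique))
      where
        split∘walk≡id : map split (timesWalks k l r A B) ≡ cartesianProduct A B
        split∘walk≡id = trans (sym (map-∘ (cartesianProduct A B)))
          (map-id-local (All.tabulate λ {ab} ab∈ → split-walk (proj₁ ab) (proj₂ ab) (proj₁ (∈-cartesianProduct⁻ A B ab∈))))

    walks-weightSum : sumE F (map (weightAlong (k , start)) (timesWalks k l r A B)) ≈ polyAt C l ⊗ polyAt C r
    walks-weightSum =
      ≋-trans (≋-reflexive (cong (sumE F) (sym (map-∘ (cartesianProduct A B)))))
        (≋-trans (sum-cong _ (λ ab → weightAlong (l , start) (proj₁ ab) ⊗ weightAlong (r , start) (proj₂ ab))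
                           (cartesianProduct A B)
                           (λ ab ab∈ → walk-weight (proj₁ ab) (proj₂ ab) (proj₁ (∈-cartesianProduct⁻ A B ab∈))))
          (≋-trans (sum-cartesian (weightAlong (l , start)) (weightAlong (r , start)) A B) (⊗-cong Sl.weightSum Sr.weightSum)))

    -- Parsing a walk through k: first a walk of l runs with (k , mid) pushed,
    -- then the return edge must pop exactly that symbol, then a walk of r runs.
    parseAfterReturn : ∀ {a} → a ∈ A → ∀ zs st → Walk (k , mid) zs →
      run (opsAlong (k , start) ((l , start) ∷ a ++ (k , mid) ∷ zs)) st ≡ run (opsAlong (k , mid) zs) st →
      run (opsAlong (k , start) ((l , start) ∷ a ++ (k , mid) ∷ zs)) st ≢ nothing →
      Parse k timesPlan ((l , start) ∷ a ++ (k , mid) ∷ zs) st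
    parseAfterReturn {a} a∈ [] st w run≡ ok =
      incomplete [] run≡ (inj₁ λ e → mid≢end (trans (sym (endpoint-++ (l , start) a [ (k , mid) ])) e))
      where
        mid≢end : endpoint (endpoint (l , start) a) [ (k , mid) ] ≢ (exitOf r , end)
        mid≢end ()
    parseAfterReturn {a} a∈ (x ∷ zs) st (wcons eq w) run≡ ok with resume-only x _ eq
    ... | refl , refl with Sr.parse zs st w (λ e → ok (trans run≡ (trans (run-∷ {k , mid} {r , start} zs st eq) e)))
    ...   | incomplete σ run≡′ elsewhere = incomplete σ (trans run≡ (trans (run-∷ {k , mid} {r , start} zs st eq) run≡′))
              (map₁ (λ ne e → ne (trans (sym (trans (endpoint-++ (l , start) a _)
                       (cong (λ v → endpoint v ((k , mid) ∷ (r , start) ∷ zs)) (Sl.endsAtExit a a∈)))) e)) elsewhere)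
    ...   | extends {b} zs′ b∈ refl = extends zs′ (∈-map⁺ walk (∈-cartesianProduct⁺ a∈ b∈))
              (cong ((l , start) ∷_) (sym (++-assoc a ((k , mid) ∷ (r , start) ∷ b) zs′)))

    parseAfterLeft : ∀ {a} → a ∈ A → ∀ zs st → Walk (exitOf l , end) zs →
      run (opsAlong (k , start) ((l , start) ∷ a ++ zs)) st ≡ run (opsAlong (exitOf l , end) zs) ((k , mid) ∷ st) →
      run (opsAlong (k , start) ((l , start) ∷ a ++ zs)) st ≢ nothing →
      Parse k timesPlan ((l , start) ∷ a ++ zs) st
    parseAfterLeft a∈ [] st w run≡ ok = incomplete [ (k , mid) ] run≡ (inj₂ λ ())
    parseAfterLeft a∈ (x ∷ zs) st (wcons eq w) run≡ ok with pop-step {exitOf l} {x} {zs = zs} eq (λ e → ok (trans run≡ e))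
    ... | refl , run≡′ = parseAfterReturn a∈ zs st w (trans run≡ run≡′) ok

    timesParse : ∀ ys st → Walk (k , start) ys → run (opsAlong (k , start) ys) st ≢ nothing → Parse k timesPlan ys st
    timesParse [] st w ok = incomplete [] refl (inj₁ λ ())
    timesParse (x ∷ ys) st (wcons eq w) ok with enter-only x _ eq
    ... | refl , refl with Sl.parse ys ((k , mid) ∷ st) w (λ e → ok (trans (run-∷ {k , start} {l , start} ys st eq) e))
    ...   | incomplete σ run≡ _ = incomplete (σ ++ [ (k , mid) ])
              (trans (run-∷ {k , start} {l , start} ys st eq) (trans run≡ (cong just (sym (++-assoc σ _ st)))))
              (inj₂ λ e → case ++-conicalʳ σ _ e of λ ())
    ...   | extends {a} zs a∈ refl = parseAfterLeft a∈ zs st (subst (λ u → Walk u zs) (Sl.endsAtExit a a∈) (walk-suffix a w))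
              (trans (run-∷ {k , start} {l , start} (a ++ zs) st eq)
                     (run-balanced-prefix a zs ((k , mid) ∷ st) (Sl.endsAtExit a a∈) (Sl.balanced a a∈)))
              ok

    forEachWalk : ∀ {q} {Q : List Vertex → Set q} → (∀ {a b} → a ∈ A → b ∈ B → Q (walk (a , b))) →
                  ∀ w → w ∈ timesWalks k l r A B → Q w
    forEachWalk f w w∈ with ∈-map⁻ walk w∈
    ... | (a , b) , ab∈ , refl = f (proj₁ (∈-cartesianProduct⁻ A B ab∈)) (proj₂ (∈-cartesianProduct⁻ A B ab∈))

    timesSpec : GateSpec k timesPlan (polyAt C l ⊗ polyAt C r)
    timesSpec = record
      { isWalk     = forEachWalk walk-isWalk
      ; endsAtExit = forEachWalk walk-endpoint
      ; hasSpan    = forEachWalk walk-length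
      ; balanced   = forEachWalk walk-balanced
      ; unique     = walks-unique
      ; exit<s     = Sr.exit<s
      ; weightSum  = walks-weightSum
      ; parse      = timesParse
      }

-- Each branch through a child c is
--   k₋ → (c , start) ⋯ (exitOf c , end) → Y → (padding chain) → k₊,
-- where Y = padHead k d is pushed on entering and popped on returning, and
-- the padding d makes both branches equally long.  If l ≠ r the walks of k
-- are those of both branches; if l = r there is one branch of weight 2.
module PlusGate {c ℓ} (F : Field c ℓ) (maxSpan : ℕ) {s} (C : Circuit F s) where

  open import Data.Nat using (zero; suc; _+_; _<_; _≤_)
  open import Data.List using (List; []; _∷_; _++_; [_]; map; length; replicate)
  open import Data.List.Properties using (++-assoc; length-++; map-∘; ++-cancelʳ; ∷-injective; ++-conicalʳ)
  open import Data.List.Membership.Propositional using (_∈_)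
  open import Data.List.Membership.Propositional.Properties using (∈-map⁻; ∈-map⁺; ∈-++⁺ˡ; ∈-++⁺ʳ; ∈-++⁻)
  open import Data.List.Relation.Unary.Unique.Propositional using (Unique)
  import Data.List.Relation.Unary.Unique.Propositional.Properties as Unique
  open import Data.Maybe using (just; nothing)
  open import Data.Product using (_×_; _,_; proj₁; proj₂)
  open import Data.Sum using (_⊎_; inj₁; inj₂)
  open import Function using (case_of_)
  open import Relation.Nullary using (¬_)
  open import Relation.Binary.PropositionalEquality hiding ([_])
  open StackMachine
  open Invariant F maxSpan C
  open PolyAlgebra F using (_≈_; ≋-reflexive; prod-++; prod-ones; ⊗-idˡ; sum-cong; sum-scaleˡ; sum-map-++)

  private module F = Field F

  module Branch (k c d m : ℕ) (wc : Weight F) (k<s : k < s) (d≤ : d ≤ suc maxSpan) (Sc : Spec c)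
    (enterEdge  : edge (k , start) (c , start) ≡ just (wc , push↑ (padHead k d)))
    (returnEdge : edge (exitOf c , end) (padHead k d) ≡ just (one , pop↓ (padHead k d)))
    (length≡    : suc (spanOf c + suc d) ≡ m) where

    private
      module Sc = GateSpec Sc
      A : List (List Vertex)
      A = walksOf c
      Y : Vertex
      Y = padHead k d

    walk : List Vertex → List Vertex
    walk = branchWalk k c d

    branchPlan : Plan
    branchPlan = plan m k (branchWalks k c d A)

    walk-ops : ∀ a → a ∈ A → opsAlong (k , start) (walk a)
               ≡ push↑ Y ∷ (opsAlong (c , start) a ++ pop↓ Y ∷ replicate d noop)
    walk-ops a a∈ =
      trans (opsAlong-through {k , start} {c , start} a _ enterEdge (Sc.endsAtExit a a∈))
            (cong (λ P → push↑ Y ∷ (opsAlong (c , start) a ++ P))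
                  (trans (opsAlong-∷ {exitOf c , end} {Y} (padChainTail k d) returnEdge)
                         (cong (pop↓ Y ∷_) (padChain-ops d k<s d≤))))

    walk-weights : ∀ a → a ∈ A → weightsAlong (k , start) (walk a)
                   ≡ weightExpr F wc ∷ (weightsAlong (c , start) a ++ con F.1# ∷ replicate d (con F.1#))
    walk-weights a a∈ =
      trans (weightsAlong-through {k , start} {c , start} a _ enterEdge (Sc.endsAtExit a a∈))
            (cong (λ ws → weightExpr F wc ∷ (weightsAlong (c , start) a ++ ws))
                  (trans (weightsAlong-∷ {exitOf c , end} {Y} (padChainTail k d) returnEdge)
                         (cong (con F.1# ∷_) (padChain-weights d k<s d≤))))

    walk-weight : ∀ a → a ∈ A → weightAlong (k , start) (walk a) ≈ weightExpr F wc ⊗ weightAlong (c , start) a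
    walk-weight a a∈ rewrite walk-weights a a∈ =
      ⊗-cong ≋-refl (≋-trans (prod-++ (weightsAlong (c , start) a) _)
        (≋-trans (⊗-cong ≋-refl (≋-trans (⊗-idˡ _) (prod-ones d))) (⊗-idʳ _)))

    walk-isWalk : ∀ {a} → a ∈ A → Walk (k , start) (walk a)
    walk-isWalk {a} a∈ =
      wcons enterEdge (walk-++ (Sc.isWalk a a∈)
        (subst (λ u → Walk u (padChain k d)) (sym (Sc.endsAtExit a a∈))
          (wcons returnEdge (padChain-walk d k<s d≤))))

    walk-endpoint : ∀ {a} → a ∈ A → endpoint (k , start) (walk a) ≡ (k , end)
    walk-endpoint {a} a∈ =
      trans (endpoint-++ (c , start) a (padChain k d))
        (trans (cong (λ v → endpoint v (padChain k d)) (Sc.endsAtExit a a∈)) (padChain-endpoint k d))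

    walk-length : ∀ {a} → a ∈ A → length (walk a) ≡ m
    walk-length {a} a∈ =
      trans (cong suc (trans (length-++ a) (cong₂ (λ x y → x + suc y) (Sc.hasSpan a a∈) (padChain-length k d)))) length≡

    walk-balanced : ∀ {a} → a ∈ A → Balanced (opsAlong (k , start) (walk a))
    walk-balanced {a} a∈ =
      subst Balanced (sym (walk-ops a a∈))
        (subst Balanced (++-assoc (push↑ Y ∷ opsAlong (c , start) a) [ pop↓ Y ] (replicate d noop))
          (cat (wrap Y (Sc.balanced a a∈)) (noops d)))
      where
        noops : ∀ d → Balanced (replicate d (noop {A = Vertex}))
        noops zero = empty
        noops (suc d) = nopˡ (noops d)

    walks-unique : Unique (branchWalks k c d A)
    walks-unique = Unique.map⁺ (λ {a} {a′} eq → ++-cancelʳ (padChain k d) a a′ (proj₂ (∷-injective eq))) Sc.unique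

    walks-weightSum : sumE F (map (weightAlong (k , start)) (branchWalks k c d A)) ≈ weightExpr F wc ⊗ polyAt C c
    walks-weightSum =
      ≋-trans (≋-reflexive (cong (sumE F) (sym (map-∘ A))))
        (≋-trans (sum-cong _ (λ a → weightExpr F wc ⊗ weightAlong (c , start) a) A walk-weight)
          (≋-trans (sum-scaleˡ (weightExpr F wc) (weightAlong (c , start)) A) (⊗-cong ≋-refl Sc.weightSum)))

    forEachWalk : ∀ {q} {Q : List Vertex → Set q} → (∀ {a} → a ∈ A → Q (walk a)) →
                  ∀ w → w ∈ branchWalks k c d A → Q w
    forEachWalk f w w∈ with ∈-map⁻ walk w∈
    ... | a , a∈ , refl = f a∈

    parseAfterChild : ∀ {a} → a ∈ A → ∀ zs st → Walk (exitOf c , end) zs →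
      run (opsAlong (k , start) ((c , start) ∷ a ++ zs)) st ≡ run (opsAlong (exitOf c , end) zs) (Y ∷ st) →
      run (opsAlong (k , start) ((c , start) ∷ a ++ zs)) st ≢ nothing →
      Parse k branchPlan ((c , start) ∷ a ++ zs) st
    parseAfterChild a∈ [] st w run≡ ok = incomplete [ Y ] run≡ (inj₂ λ ())
    parseAfterChild {a} a∈ (x ∷ zs) st (wcons eq w) run≡ ok
      with pop-step {exitOf c} {x} {zs = zs} eq (λ e → ok (trans run≡ e))
    ... | refl , run≡′ with padChain-parse d zs w
    ...   | inj₁ (elsewhere , chain-run) =
            incomplete [] (trans run≡ (trans run≡′ (chain-run st)))
              (inj₁ λ e → elsewhere (trans (sym (trans (endpoint-++ (c , start) a (Y ∷ zs))
                                                       (cong (λ v → endpoint v (Y ∷ zs)) (Sc.endsAtExit a a∈)))) e))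
    ...   | inj₂ (zs′ , refl) = extends zs′ (∈-map⁺ walk a∈)
            (cong ((c , start) ∷_) (sym (++-assoc a (padChain k d) zs′)))

    branchParse : ∀ ys st → Walk (c , start) ys →
      run (opsAlong (k , start) ((c , start) ∷ ys)) st ≢ nothing →
      Parse k branchPlan ((c , start) ∷ ys) st
    branchParse ys st w ok with Sc.parse ys (Y ∷ st) w (λ e → ok (trans (run-∷ {k , start} {c , start} ys st enterEdge) e))
    ... | incomplete σ run≡ _ = incomplete (σ ++ [ Y ])
            (trans (run-∷ {k , start} {c , start} ys st enterEdge) (trans run≡ (cong just (sym (++-assoc σ _ st)))))
            (inj₂ λ e → case ++-conicalʳ σ _ e of λ ())
    ... | extends {a} zs a∈ refl = parseAfterChild a∈ zs st (subst (λ u → Walk u zs) (Sc.endsAtExit a a∈) (walk-suffix a w))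
            (trans (run-∷ {k , start} {c , start} (a ++ zs) st enterEdge)
                   (run-balanced-prefix a zs (Y ∷ st) (Sc.endsAtExit a a∈) (Sc.balanced a a∈)))
            ok

  module _ (k l r m dl dr : ℕ) (k<s : k < s) (l≢r : l ≢ r) (Sl : Spec l) (Sr : Spec r)
    (enter-only : ∀ y e → edge (k , start) y ≡ just e →
       (y ≡ (l , start) × e ≡ (one , push↑ (padHead k dl))) ⊎ (y ≡ (r , start) × e ≡ (one , push↑ (padHead k dr))))
    (enterˡ : edge (k , start) (l , start) ≡ just (one , push↑ (padHead k dl)))
    (enterʳ : edge (k , start) (r , start) ≡ just (one , push↑ (padHead k dr)))
    (returnˡ : edge (exitOf l , end) (padHead k dl) ≡ just (one , pop↓ (padHead k dl)))
    (returnʳ : edge (exitOf r , end) (padHead k dr) ≡ just (one , pop↓ (padHead k dr)))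
    (dl≤ : dl ≤ suc maxSpan) (dr≤ : dr ≤ suc maxSpan)
    (lengthˡ : suc (spanOf l + suc dl) ≡ m) (lengthʳ : suc (spanOf r + suc dr) ≡ m) where
    private
      module L = Branch k l dl m one k<s dl≤ Sl enterˡ returnˡ lengthˡ
      module R = Branch k r dr m one k<s dr≤ Sr enterʳ returnʳ lengthʳ
      Wl Wr : List (List Vertex)
      Wl = branchWalks k l dl (walksOf l)
      Wr = branchWalks k r dr (walksOf r)

    plusPlan : Plan
    plusPlan = plan m k (Wl ++ Wr)

    forEachWalk : ∀ {q} {Q : List Vertex → Set q} → (∀ {a} → a ∈ walksOf l → Q (L.walk a)) →
                  (∀ {b} → b ∈ walksOf r → Q (R.walk b)) → ∀ w → w ∈ Wl ++ Wr → Q w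
    forEachWalk {Q = Q} fl fr w w∈ with ∈-++⁻ Wl w∈
    ... | inj₁ w∈l = L.forEachWalk {Q = Q} fl w w∈l
    ... | inj₂ w∈r = R.forEachWalk {Q = Q} fr w w∈r

    -- the branches are disjoint: they start with different children
    branches-disjoint : ∀ {w} → ¬ (w ∈ Wl × w ∈ Wr)
    branches-disjoint (w∈l , w∈r) with ∈-map⁻ L.walk w∈l | ∈-map⁻ R.walk w∈r
    ... | _ , _ , refl | _ , _ , eq = l≢r (cong proj₁ (proj₁ (∷-injective eq)))

    plusParse : ∀ ys st → Walk (k , start) ys → run (opsAlong (k , start) ys) st ≢ nothing → Parse k plusPlan ys st
    plusParse [] st w ok = incomplete [] refl (inj₁ λ ())
    plusParse (x ∷ ys) st (wcons eq w) ok with enter-only x _ eq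
    ... | inj₁ (refl , refl) = parse-widen {k} {L.branchPlan} refl ∈-++⁺ˡ (L.branchParse ys st w ok)
    ... | inj₂ (refl , refl) = parse-widen {k} {R.branchPlan} refl (∈-++⁺ʳ Wl) (R.branchParse ys st w ok)

    plusSpec : GateSpec k plusPlan (polyAt C l ⊕ polyAt C r)
    plusSpec = record
      { isWalk     = forEachWalk L.walk-isWalk R.walk-isWalk
      ; endsAtExit = forEachWalk L.walk-endpoint R.walk-endpoint
      ; hasSpan    = forEachWalk L.walk-length R.walk-length
      ; balanced   = forEachWalk L.walk-balanced R.walk-balanced
      ; unique     = Unique.++⁺ L.walks-unique R.walks-unique branches-disjoint
      ; exit<s     = k<s
      ; weightSum  = ≋-trans (sum-map-++ (weightAlong (k , start)) Wl Wr)
                       (⊕-cong (≋-trans L.walks-weightSum (⊗-idˡ _)) (≋-trans R.walks-weightSum (⊗-idˡ _)))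
      ; parse      = plusParse
      }

  module _ (k l m d : ℕ) (k<s : k < s) (Sl : Spec l)
    (enter-only : ∀ y e → edge (k , start) y ≡ just e → y ≡ (l , start) × e ≡ (two , push↑ (padHead k d)))
    (enterEdge : edge (k , start) (l , start) ≡ just (two , push↑ (padHead k d)))
    (returnEdge : edge (exitOf l , end) (padHead k d) ≡ just (one , pop↓ (padHead k d)))
    (d≤ : d ≤ suc maxSpan) (length≡ : suc (spanOf l + suc d) ≡ m) where
    private
      module L = Branch k l d m two k<s d≤ Sl enterEdge returnEdge length≡

    doubleParse : ∀ ys st → Walk (k , start) ys → run (opsAlong (k , start) ys) st ≢ nothing →
                  Parse k L.branchPlan ys st
    doubleParse [] st w ok = incomplete [] refl (inj₁ λ ())
    doubleParse (x ∷ ys) st (wcons eq w) ok with enter-only x _ eq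
    ... | refl , refl = L.branchParse ys st w ok

    doubleSpec : GateSpec k L.branchPlan (polyAt C l ⊕ polyAt C l)
    doubleSpec = record
      { isWalk     = L.forEachWalk L.walk-isWalk
      ; endsAtExit = L.forEachWalk L.walk-endpoint
      ; hasSpan    = L.forEachWalk L.walk-length
      ; balanced   = L.forEachWalk L.walk-balanced
      ; unique     = L.walks-unique
      ; exit<s     = k<s
      ; weightSum  = ≋-trans L.walks-weightSum (≋-trans (⊗-cong (con-+ F.1# F.1#) ≋-refl)
                       (≋-trans (distribʳ _ _ _) (⊕-cong (⊗-idˡ _) (⊗-idˡ _))))
      ; parse      = doubleParse
      }

-- The padding chains are long enough
-- because all spans are at most maxSpan.
module SpecInduction {c ℓ} (F : Field c ℓ) (maxSpan : ℕ) {s} (C : Circuit F s)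
  (span≤ : ∀ k → k < s → Construction.Plan.span (Construction.planAt F maxSpan C k) ≤ maxSpan) where

  open import Data.Nat using (suc; _+_; _∸_; _⊔_; _≟_)
  import Data.Nat.Properties as ℕP
  open import Data.List using ([_])
  open import Data.List.Membership.Propositional using (_∈_)
  open import Data.List.Relation.Unary.Any using (here; there)
  open import Data.Maybe using (just; nothing)
  open import Data.Product using (_×_; _,_; proj₁)
  open import Data.Sum using (_⊎_; inj₁; inj₂)
  open import Relation.Nullary using (yes; no)
  open import Relation.Binary.PropositionalEquality hiding ([_])
  open StackMachine
  open Invariant F maxSpan C
  open TimesGate F maxSpan C using (timesSpec)
  open PlusGate F maxSpan C using (plusSpec; doubleSpec)

  padding≤ : ∀ {l r} mc → l < s → r < s → padding mc (spanOf l) (spanOf r) ≤ suc maxSpan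
  padding≤ mc l<s r<s =
    ℕP.≤-trans (ℕP.m∸n≤m _ mc) (ℕP.≤-trans (ℕP.⊔-lub (span≤ _ l<s) (span≤ _ r<s)) (ℕP.n≤1+n maxSpan))

  padded-length : ∀ mc m → mc ≤ m → suc (mc + suc (m ∸ mc)) ≡ suc (suc m)
  padded-length mc m mc≤m = cong suc (trans (ℕP.+-suc mc (m ∸ mc)) (cong suc (ℕP.m+[n∸m]≡n mc≤m)))

  leafCase : ∀ k wgt → k < s →
    (∀ y → edge₀ (k , start) y ≡ ifDec (y ≟V (k , end)) (just (wgt , noop)) nothing) →
    GateSpec k (plan 1 k [ [ (k , end) ] ]) (weightExpr F wgt)
  leafCase k wgt k<s out = leafSpec k wgt k<s (single-only (k , start) out) (single-edge (k , start) out (end-in k<s))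

  timesCase : ∀ {k l r} → k < s → l < k → r < k → kindOf k ≡ timesK l r → Spec l → Spec r →
    GateSpec k (plan (suc (spanOf l + suc (suc (spanOf r)))) (exitOf r) (timesWalks k l r (walksOf l) (walksOf r)))
               (polyAt C l ⊗ polyAt C r)
  timesCase {k} {l} {r} k<s l<k r<k kind≡ Sl Sr =
    timesSpec k l r (single-only (k , start) enter) (single-edge (k , start) enter (start-in (ℕP.<-trans l<k k<s)))
      (return-edge (mid-in k<s) (subst (λ K → ((k , mid) , (exitOf l , end)) ∈ returnEdges k K) (sym kind≡) (here refl)))
      (single-only (k , mid) resume) (single-edge (k , mid) resume (start-in (ℕP.<-trans r<k k<s))) Sl Sr
    where
      enter : ∀ y → edge₀ (k , start) y ≡ ifDec (y ≟V (l , start)) (just (one , push↑ (k , mid))) nothing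
      enter y = cong (λ K → startEdge k K y) kind≡
      resume : ∀ y → edge₀ (k , mid) y ≡ ifDec (y ≟V (r , start)) (just (one , noop)) nothing
      resume y = cong (λ K → midEdge k K y) kind≡

  plusCase : ∀ {k l r} → k < s → l < k → r < k → kindOf k ≡ plusK l r → Spec l → Spec r →
    GateSpec k (plan (suc (suc (spanOf l ⊔ spanOf r))) k
                     (plusWalks k l r (padˡ l r) (padʳ l r) (walksOf l) (walksOf r)))
               (polyAt C l ⊕ polyAt C r)
  plusCase {k} {l} {r} k<s l<k r<k kind≡ Sl Sr with l ≟ r
  ... | yes refl =
    doubleSpec k l _ (padˡ l l) k<s Sl (single-only (k , start) enter) (single-edge (k , start) enter (start-in l<s))
      (return-edge (padHead-inRange k<s d≤) (subst (λ K → (padHead k (padˡ l l) , (exitOf l , end)) ∈ returnEdges k K)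
                                                    (sym kind≡) (here refl)))
      d≤ (padded-length (spanOf l) _ (ℕP.m≤m⊔n _ _))
    where
      l<s : l < s
      l<s = ℕP.<-trans l<k k<s
      d≤ : padˡ l l ≤ suc maxSpan
      d≤ = padding≤ (spanOf l) l<s l<s
      enter : ∀ y → edge₀ (k , start) y ≡ ifDec (y ≟V (l , start)) (just (two , push↑ (padHead k (padˡ l l)))) nothing
      enter y = trans (cong (λ K → startEdge k K y) kind≡) (ifDec-yes (l ≟ l) refl)
  ... | no l≢r =
    plusSpec k l r _ (padˡ l r) (padʳ l r) k<s l≢r Sl Sr enter-only
      (edge-intro {k , start} {l , start} (start-in l<s) (trans (enter (l , start)) (ifDec-yes ((l , start) ≟V (l , start)) refl)))
      (edge-intro {k , start} {r , start} (start-in r<s)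
        (trans (enter (r , start)) (trans (ifDec-no ((r , start) ≟V (l , start)) (λ e → l≢r (sym (cong proj₁ e))))
                                          (ifDec-yes ((r , start) ≟V (r , start)) refl))))
      (return-edge (padHead-inRange k<s dl≤) (waiting (here refl)))
      (return-edge (padHead-inRange k<s dr≤) (waiting (there (here refl))))
      dl≤ dr≤ (padded-length (spanOf l) _ (ℕP.m≤m⊔n _ _)) (padded-length (spanOf r) _ (ℕP.m≤n⊔m _ _))
    where
      l<s : l < s
      l<s = ℕP.<-trans l<k k<s
      r<s : r < s
      r<s = ℕP.<-trans r<k k<s
      dl≤ : padˡ l r ≤ suc maxSpan
      dl≤ = padding≤ (spanOf l) l<s r<s
      dr≤ : padʳ l r ≤ suc maxSpan
      dr≤ = padding≤ (spanOf r) l<s r<s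
      waiting : ∀ {p} → p ∈ returnEdges k (plusK l r) → p ∈ returnEdges k (kindOf k)
      waiting = subst (λ K → _ ∈ returnEdges k K) (sym kind≡)
      Yl Yr : Vertex
      Yl = padHead k (padˡ l r)
      Yr = padHead k (padʳ l r)
      enter : ∀ y → edge₀ (k , start) y ≡ ifDec (y ≟V (l , start)) (just (one , push↑ Yl))
                                            (ifDec (y ≟V (r , start)) (just (one , push↑ Yr)) nothing)
      enter y = trans (cong (λ K → startEdge k K y) kind≡) (ifDec-no (l ≟ r) l≢r)
      enter-only : ∀ y e → edge (k , start) y ≡ just e →
                   (y ≡ (l , start) × e ≡ (one , push↑ Yl)) ⊎ (y ≡ (r , start) × e ≡ (one , push↑ Yr))
      enter-only y e eq with y ≟V (l , start) | trans (sym (enter y)) (proj₁ (edge-inv {k , start} {y} eq))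
      ... | yes y≡l | refl = inj₁ (y≡l , refl)
      ... | no _    | eq′ with ifDec-just (y ≟V (r , start)) eq′
      ...   | y≡r , refl = inj₂ (y≡r , refl)

  spec-step : ∀ k → k < s → (∀ j → j < k → Spec j) → Spec k
  spec-step k k<s IH with kindAt C k in kind≡ | unfolds C k k<s
  ... | constK a | plan≡ , poly≡ =
    subst₂ (GateSpec k) (sym plan≡) (sym poly≡) (leafCase k (cst a) k<s λ y → cong (λ K → startEdge k K y) kind≡)
  ... | inputK i | plan≡ , poly≡ =
    subst₂ (GateSpec k) (sym plan≡) (sym poly≡) (leafCase k (X i) k<s λ y → cong (λ K → startEdge k K y) kind≡)
  ... | timesK l r | l<k , r<k , plan≡ , poly≡ =
    subst₂ (GateSpec k) (sym plan≡) (sym poly≡) (timesCase k<s l<k r<k kind≡ (IH l l<k) (IH r r<k))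
  ... | plusK l r | l<k , r<k , plan≡ , poly≡ =
    subst₂ (GateSpec k) (sym plan≡) (sym poly≡) (plusCase k<s l<k r<k kind≡ (IH l l<k) (IH r r<k))

  spec : ∀ k → k < s → Spec k
  spec = <-rec-bounded
    where
      open import Data.Nat.Induction using (<-rec)
      <-rec-bounded : ∀ k → k < s → Spec k
      <-rec-bounded = <-rec (λ k → k < s → Spec k) λ k IH k<s → spec-step k k<s λ j j<k → IH j<k (ℕP.<-trans j<k k<s)

-- The program on the vertex set Fin N, N = s · tagBound: a vertex (k , t) in
-- range gets the number k · tagBound + tagCode t.  Walks of the program are
-- exactly the numbered walks of the graph on ℕ × Tag, with the same weights;
-- every stack symbol that occurs is in range, where the numbering is
-- injective, so stack realizability is preserved in both directions.
module Encoding {c ℓ} (F : Field c ℓ) (maxSpan : ℕ) {s′} (C : Circuit F (suc s′))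
  (span≤ : ∀ k → k < suc s′ → Construction.Plan.span (Construction.planAt F maxSpan C k) ≤ maxSpan) where

  open import Data.Nat using (_*_; _≟_; NonZero)
  import Data.Nat.Properties as ℕP
  open import Data.Nat.DivMod using (_mod_; m<n⇒m%n≡m)
  open import Data.Fin as Fin using (Fin; toℕ; combine; remQuot)
  import Data.Fin.Properties as FinP
  open import Data.List using (List; []; _∷_; _++_; map; length)
  open import Data.List.Properties using (map-++)
  open import Data.List.Relation.Unary.All using (All; []; _∷_)
  open import Data.Maybe as Maybe using (Maybe; just; nothing; maybe; Is-just)
  import Data.Maybe.Relation.Unary.Any as MaybeAny
  open import Data.Product using (Σ-syntax; _×_; _,_; proj₁; proj₂)
  open import Data.Unit using (tt)
  open import Relation.Nullary using (yes; no)
  open import Relation.Binary.PropositionalEquality hiding ([_])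
  open StackMachine
  open Invariant F maxSpan C
  open SpecInduction F maxSpan C span≤ using (padding≤)

  private
    s : ℕ
    s = suc s′

  N : ℕ
  N = s * tagBound

  toℕ-mod : ∀ {k n} .{{_ : NonZero n}} → k < n → toℕ (k mod n) ≡ k
  toℕ-mod {k} {n} k<n = trans (FinP.toℕ-fromℕ< _) (m<n⇒m%n≡m k<n)

  mod-toℕ : ∀ {n} .{{_ : NonZero n}} (i : Fin n) → toℕ i mod n ≡ i
  mod-toℕ i = FinP.toℕ-injective (toℕ-mod (FinP.toℕ<n i))

  encode : Vertex → Fin N
  encode (k , t) = combine (k mod s) (tagCode t mod tagBound)

  decode : Fin N → Vertex
  decode i = toℕ (proj₁ (remQuot {s} tagBound i)) , tagDecode (toℕ (proj₂ (remQuot {s} tagBound i)))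

  decode-encode : ∀ {x} → InRange s x → decode (encode x) ≡ x
  decode-encode {k , t} (k<s , t<B) =
    trans (cong (λ q → toℕ (proj₁ q) , tagDecode (toℕ (proj₂ q))) (FinP.remQuot-combine (k mod s) (tagCode t mod tagBound)))
          (cong₂ _,_ (toℕ-mod k<s) (trans (cong tagDecode (toℕ-mod t<B)) (tagDecode-code t)))

  encode-decode : ∀ i → encode (decode i) ≡ i
  encode-decode i =
    trans (cong₂ combine (mod-toℕ q) (trans (cong (_mod tagBound) (tagCode-decode (toℕ r))) (mod-toℕ r)))
          (FinP.combine-remQuot {s} tagBound i)
    where
      q : Fin s
      q = proj₁ (remQuot {s} tagBound i)
      r : Fin tagBound
      r = proj₂ (remQuot {s} tagBound i)

  encode-injective : ∀ {x y} → InRange s x → InRange s y → encode x ≡ encode y → x ≡ y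
  encode-injective x-in y-in eq = trans (sym (decode-encode x-in)) (trans (cong decode eq) (decode-encode y-in))

  decode-encode-all : ∀ {w} → All (InRange s) w → map decode (map encode w) ≡ w
  decode-encode-all [] = refl
  decode-encode-all (p ∷ ps) = cong₂ _∷_ (decode-encode p) (decode-encode-all ps)

  label : Label → Weight F × StackOp N
  label (w , o) = w , encodeOp encode o

  program : RSBP F N N
  program = record { edge = λ i j → Maybe.map label (edge (decode i) (decode j)) }

  walkOps-decode : ∀ i is → walkOps F program (i ∷ is) ≡ map (encodeOp encode) (opsAlong (decode i) (map decode is))
  walkOps-decode i [] = refl
  walkOps-decode i (j ∷ js) =
    trans (cong₂ _++_ (single (edge (decode i) (decode j))) (walkOps-decode j js))
          (sym (map-++ (encodeOp encode) (opsOf (decode i) (decode j)) _))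
    where
      single : ∀ me → maybe (λ e → proj₂ e ∷ []) [] (Maybe.map label me)
                      ≡ map (encodeOp encode) (maybe (λ e → proj₂ e ∷ []) [] me)
      single (just e) = refl
      single nothing = refl

  walkWeights-decode : ∀ i is → walkWeights F program (i ∷ is) ≡ weightsAlong (decode i) (map decode is)
  walkWeights-decode i [] = refl
  walkWeights-decode i (j ∷ js) = cong₂ _++_ (single (edge (decode i) (decode j))) (walkWeights-decode j js)
    where
      single : ∀ me → maybe (λ e → weightExpr F (proj₁ e) ∷ []) [] (Maybe.map label me)
                      ≡ maybe (λ e → weightExpr F (proj₁ e) ∷ []) [] me
      single (just e) = refl
      single nothing = refl

  walk-inRange : ∀ {u ys} → Walk u ys → All (InRange s) ys
  walk-inRange wnil = []
  walk-inRange {u} {x ∷ ys} (wcons eq w) = proj₂ (edge-inv {u} {x} eq) ∷ walk-inRange w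

  encodeWalk : ∀ {u ys} → InRange s u → Walk u ys →
               IsWalk F program (encode u) (encode (endpoint u ys)) (length ys) (encode u ∷ map encode ys)
  encodeWalk u-in wnil = here
  encodeWalk {u} {x ∷ ys} u-in (wcons eq w) =
    step (subst (λ me → Is-just (Maybe.map label me))
                (sym (trans (cong₂ edge (decode-encode {u} u-in) (decode-encode {x} x-in)) eq)) (MaybeAny.just tt))
         (encodeWalk x-in w)
    where
      x-in : InRange s x
      x-in = proj₂ (edge-inv {u} {x} eq)

  decodeWalk : ∀ {i j m xs} → IsWalk F program i j m xs →
    Σ[ zs ∈ List Vertex ] xs ≡ i ∷ map encode zs × Walk (decode i) zs × endpoint (decode i) zs ≡ decode j × length zs ≡ m
  decodeWalk here = [] , refl , wnil , refl , refl
  decodeWalk {i} (step {x = x} has-edge w) with decodeWalk w | edge (decode i) (decode x) in eq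
  ... | zs , refl , wz , end≡ , len≡ | just e =
    decode x ∷ zs , cong (λ y → i ∷ y ∷ map encode zs) (sym (encode-decode x)) , wcons eq wz , end≡ , cong suc len≡
  decodeWalk {i} (step {x = x} () w) | _ | nothing

  open EncodedRun _≟V_ encode (InRange s) encode-injective

  startEdge-symbol : ∀ k y e → k < s → startEdge k (kindOf k) y ≡ just e → GoodOp (proj₂ e)
  startEdge-symbol k y e k<s eq with kindAt C k | unfolds C k k<s
  ... | constK a | _ with ifDec-just (y ≟V (k , end)) eq
  ...   | _ , refl = tt
  startEdge-symbol k y e k<s eq | inputK i | _ with ifDec-just (y ≟V (k , end)) eq
  ...   | _ , refl = tt
  startEdge-symbol k y e k<s eq | timesK l r | _ with ifDec-just (y ≟V (l , start)) eq
  ...   | _ , refl = mid-in k<s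
  startEdge-symbol k y e k<s eq | plusK l r | l<k , r<k , _ with l ≟ r
  ...   | yes refl with ifDec-just (y ≟V (l , start)) eq
  ...     | _ , refl = padHead-inRange k<s (padding≤ (spanOf l) (ℕP.<-trans l<k k<s) (ℕP.<-trans r<k k<s))
  startEdge-symbol k y e k<s eq | plusK l r | l<k , r<k , _ | no _ with y ≟V (l , start)
  ...   | yes _ with eq
  ...     | refl = padHead-inRange k<s (padding≤ (spanOf l) (ℕP.<-trans l<k k<s) (ℕP.<-trans r<k k<s))
  startEdge-symbol k y e k<s eq | plusK l r | l<k , r<k , _ | no _ | no _ with ifDec-just (y ≟V (r , start)) eq
  ...     | _ , refl = padHead-inRange k<s (padding≤ (spanOf r) (ℕP.<-trans l<k k<s) (ℕP.<-trans r<k k<s))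

  edge-symbol : ∀ {u x e} → InRange s u → edge u x ≡ just e → GoodOp (proj₂ e)
  edge-symbol {k , start} {y} {e} (k<s , _) eq = startEdge-symbol k y e k<s (proj₁ (edge-inv {k , start} {y} eq))
  edge-symbol {k , mid} {y} {e} _ eq with kindAt C k | proj₁ (edge-inv {k , mid} {y} eq)
  ... | timesK l r | eq′ with ifDec-just (y ≟V (r , start)) eq′
  ...   | _ , refl = tt
  edge-symbol {k , pad e′} {y} {e} _ eq with padChain-edge-inv {k} {e′} {y} eq
  ... | _ , refl = tt
  edge-symbol {k , end} {y} {e} _ eq with endEdge-inv {k} {y} eq
  ... | refl = proj₂ (edge-inv {k , end} {y} eq)

  walk-symbols : ∀ {u ys} → InRange s u → Walk u ys → All GoodOp (opsAlong u ys)
  walk-symbols u-in wnil = []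
  walk-symbols {u} {x ∷ ys} u-in (wcons eq w) =
    subst (All GoodOp) (sym (opsAlong-∷ {u} {x} ys eq))
      (edge-symbol {u} {x} u-in eq ∷ walk-symbols (proj₂ (edge-inv {u} {x} eq)) w)

  module _ {u zs} (u-in : InRange s u) (w : Walk u zs) where
    private
      decoded : map decode (map encode zs) ≡ zs
      decoded = decode-encode-all (walk-inRange w)

    walkOps-encode : walkOps F program (encode u ∷ map encode zs) ≡ map (encodeOp encode) (opsAlong u zs)
    walkOps-encode = trans (walkOps-decode (encode u) (map encode zs))
      (cong₂ (λ x ys → map (encodeOp encode) (opsAlong x ys)) (decode-encode u-in) decoded)

    walkWeight-encode : walkWeight F program (encode u ∷ map encode zs) ≡ weightAlong u zs
    walkWeight-encode = cong (prodE F) (trans (walkWeights-decode (encode u) (map encode zs))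
      (cong₂ weightsAlong (decode-encode u-in) decoded))

    balanced⇒realizable : Balanced (opsAlong u zs) → Realizable (walkOps F program (encode u ∷ map encode zs))
    balanced⇒realizable bal = subst Realizable (sym walkOps-encode) (Balanced⇒Realizable encode bal)

    -- A realizable walk of the program is accepted by the machine on Fin N;
    -- as the encoding is injective on the symbols involved, the machine on
    -- Vertex runs from the empty stack back to the empty stack.
    realizable⇒encodedRun : Realizable (walkOps F program (encode u ∷ map encode zs)) →
                            Maybe.map (map encode) (run (opsAlong u zs) []) ≡ just []
    realizable⇒encodedRun real = trans (sym (run-encode (opsAlong u zs) [] (walk-symbols u-in w) []))
      (balanced-runFin (subst (λ Q → Balanced (map decodeOp Q)) walkOps-encode (Realizable⇒Balanced real)) [])
      where open Machine (Fin._≟_ {N}) using () renaming (balanced-run to balanced-runFin)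

    realizable⇒run : Realizable (walkOps F program (encode u ∷ map encode zs)) → run (opsAlong u zs) [] ≡ just []
    realizable⇒run real with run (opsAlong u zs) [] | realizable⇒encodedRun real
    ... | just [] | _ = refl

-- The program for a nonempty multiplicatively disjoint circuit, with
-- maxSpan = 2s, and the properties of gate v's vertices v₋ = (k , start)
-- and v₊ = (exitOf k , end), k = level v, with m_v = spanOf k.
module Simulation {c ℓ} (F : Field c ℓ) {s′} (C : Circuit F (suc s′)) (md : MultDisjoint F C) where

  open import Data.Nat using (_+_; _*_; _<_; _≤_; s≤s; z≤n)
  import Data.Nat.Properties as ℕP
  open import Data.Fin using (Fin)
  open import Data.Fin.Subset using (∣_∣)
  open import Data.Fin.Subset.Properties using (∣p∣≤n)
  open import Data.List using (List; []; _∷_; _++_; map; length)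
  open import Data.List.Properties using (length-++; map-∘; map-id-local; ++-identityʳ)
  open import Data.List.Membership.Propositional using (_∈_)
  open import Data.List.Membership.Propositional.Properties using (∈-map⁻; ∈-map⁺)
  import Data.List.Relation.Unary.All as All
  open import Data.List.Relation.Unary.Unique.Propositional using (Unique)
  import Data.List.Relation.Unary.Unique.Propositional.Properties as Unique
  open import Data.Product using (Σ-syntax; _×_; _,_)
  open import Data.Sum using (inj₁; inj₂)
  open import Data.Empty using (⊥-elim)
  open import Data.Maybe using (just)
  open import Data.Maybe.Properties using (just-injective)
  open import Function.Bundles using (mk⇔)
  open import Function using (case_of_)
  open import Relation.Nullary using (¬_)
  open import Relation.Binary.PropositionalEquality hiding ([_])
  open StackMachine

  s : ℕ
  s = suc s′

  maxSpan : ℕ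
  maxSpan = 2 * s

  open Invariant F maxSpan C
  open SpanBound F maxSpan using (span-bound)

  -- all walks have length below 2|C_v| ≤ 2s
  span≤ : ∀ k → k < s → span (planAt C k) ≤ maxSpan
  span≤ k k<s with level-onto k k<s
  ... | v , refl = ℕP.≤-trans (ℕP.n≤1+n _) (ℕP.≤-trans (span-bound C md v) (ℕP.*-monoʳ-≤ 2 (∣p∣≤n (subGates F C v))))

  open SpecInduction F maxSpan C span≤ using (spec)
  open Encoding F maxSpan C span≤ public using (N; program)
  open Encoding F maxSpan C span≤ using (encode; decode; decode-encode; decodeWalk; encodeWalk;
    walk-inRange; decode-encode-all; walkWeight-encode; balanced⇒realizable; realizable⇒run)

  -- N = s · (4 + 2s), which is the size bound minus s
  N≤ : N ≤ 2 * s * (s + 1) + 3 * s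
  N≤ = subst (N ≤_) (count s) (ℕP.m≤m+n N s)
    where
      open import Data.Nat.Tactic.RingSolver using (solve-∀)
      count : ∀ s → s * (4 + 2 * s) + s ≡ 2 * s * (s + 1) + 3 * s
      count = solve-∀

  module AtGate (v : Fin s) where
    k : ℕ
    k = level v
    k<s : k < s
    k<s = level< v
    private module S = GateSpec (spec k k<s)

    v₋ v₊ : Fin N
    v₋ = encode (k , start)
    v₊ = encode (exitOf k , end)

    m : ℕ
    m = spanOf k

    m≤ : m ≤ 4 * ∣ subGates F C v ∣
    m≤ = ℕP.≤-trans (ℕP.n≤1+n m)
           (ℕP.≤-trans (span-bound C md v) (ℕP.*-monoˡ-≤ ∣ subGates F C v ∣ {2} {4} (s≤s (s≤s z≤n))))

    ExtendsW : ℕ → List (Fin N) → Set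
    ExtendsW m′ xs = Σ[ w ∈ List Vertex ] w ∈ walksOf k × Σ[ zs ∈ List Vertex ]
                       xs ≡ v₋ ∷ map encode (w ++ zs) × length (w ++ zs) ≡ m′

    -- Every stack-realizable walk from v₋ to v₊ extends a walk of W_k: the
    -- machine returns to the empty stack at (exitOf k , end), which rules out
    -- the incomplete parses.
    stackWalk-prefix : ∀ m′ xs → StackWalk F program v₋ v₊ m′ xs → ExtendsW m′ xs
    stackWalk-prefix m′ xs (isWalk , real) with decodeWalk isWalk
    ... | ys , refl , w , ends , len = complete (S.parse ys [] walk (λ fails → case trans (sym returns) fails of λ ()))
      where
        walk : Walk (k , start) ys
        walk = subst (λ u → Walk u ys) (decode-encode (start-in k<s)) w
        returns : run (opsAlong (k , start) ys) [] ≡ just []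
        returns = realizable⇒run (start-in k<s) walk real
        at-exit : endpoint (k , start) ys ≡ (exitOf k , end)
        at-exit = trans (cong (λ u → endpoint u ys) (sym (decode-encode (start-in k<s))))
                        (trans ends (decode-encode (end-in S.exit<s)))
        complete : Parse k (planAt C k) ys [] → ExtendsW m′ (v₋ ∷ map encode ys)
        complete (incomplete σ run≡ (inj₁ elsewhere)) = ⊥-elim (elsewhere at-exit)
        complete (incomplete σ run≡ (inj₂ σ≢[])) =
          ⊥-elim (σ≢[] (trans (sym (++-identityʳ σ)) (just-injective (trans (sym run≡) returns))))
        complete (extends zs w∈ refl) = _ , w∈ , zs , refl , len

    no-shorter : ∀ m′ → m′ < m → ∀ xs → ¬ StackWalk F program v₋ v₊ m′ xs
    no-shorter m′ m′<m xs sw with stackWalk-prefix m′ xs sw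
    ... | w , w∈ , zs , _ , len = ℕP.<⇒≱ m′<m (begin
        m                     ≡⟨ sym (S.hasSpan w w∈) ⟩
        length w              ≤⟨ ℕP.m≤m+n (length w) (length zs) ⟩
        length w + length zs  ≡⟨ sym (length-++ w) ⟩
        length (w ++ zs)      ≡⟨ len ⟩
        m′                    ∎)
      where open ℕP.≤-Reasoning

    encodeW : List Vertex → List (Fin N)
    encodeW w = v₋ ∷ map encode w

    L : List (List (Fin N))
    L = map encodeW (walksOf k)

    W⇒stackWalk : ∀ {w} → w ∈ walksOf k → StackWalk F program v₋ v₊ m (encodeW w)
    W⇒stackWalk {w} w∈ =
      subst₂ (λ u n → IsWalk F program v₋ (encode u) n (encodeW w)) (S.endsAtExit w w∈) (S.hasSpan w w∈)
             (encodeWalk (start-in k<s) (S.isWalk w w∈)) ,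
      balanced⇒realizable (start-in k<s) (S.isWalk w w∈) (S.balanced w w∈)

    stackWalk⇒W : ∀ xs → StackWalk F program v₋ v₊ m xs → xs ∈ L
    stackWalk⇒W xs sw with stackWalk-prefix m xs sw
    ... | w , w∈ , [] , refl , _ = subst (λ u → v₋ ∷ map encode u ∈ L) (sym (++-identityʳ w)) (∈-map⁺ encodeW w∈)
    ... | w , w∈ , z ∷ zs , _ , len = ⊥-elim (ℕP.<-irrefl refl (begin-strict
        m                          ≡⟨ sym (S.hasSpan w w∈) ⟩
        length w                   <⟨ ℕP.m<m+n (length w) (s≤s z≤n) ⟩
        length w + length (z ∷ zs) ≡⟨ sym (length-++ w) ⟩
        length (w ++ z ∷ zs)       ≡⟨ len ⟩
        m                          ∎))
      where open ℕP.≤-Reasoning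

    L-unique : Unique L
    L-unique = Unique.map⁻ {f = decodeW} (subst Unique (sym decodeW∘encodeW) S.unique)
      where
        decodeW : List (Fin N) → List Vertex
        decodeW [] = []
        decodeW (_ ∷ is) = map decode is
        decodeW∘encodeW : map decodeW L ≡ walksOf k
        decodeW∘encodeW = trans (sym (map-∘ (walksOf k)))
          (map-id-local (All.tabulate λ {w} w∈ → decode-encode-all (walk-inRange (S.isWalk w w∈))))

    pathPoly : IsPathPoly F program v₋ v₊ m (poly F C v)
    pathPoly = L , L-unique , (λ xs → mk⇔ to (stackWalk⇒W xs)) , weights
      where
        open PolyAlgebra F using (≋-reflexive; sum-cong)
        to : ∀ {xs} → xs ∈ L → StackWalk F program v₋ v₊ m xs
        to xs∈ with ∈-map⁻ encodeW xs∈
        ... | w , w∈ , refl = W⇒stackWalk w∈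
        weights : _≋_ F (poly F C v) (sumE F (map (walkWeight F program) L))
        weights = ≋-sym (≋-trans (≋-reflexive (cong (sumE F) (sym (map-∘ (walksOf k)))))
          (≋-trans (sum-cong _ (weightAlong (k , start)) (walksOf k)
                     (λ w w∈ → ≋-reflexive (walkWeight-encode (start-in k<s) (S.isWalk w w∈))))
            (≋-trans S.weightSum (≋-reflexive (polyAt-level C v)))))

proposition12 : ∀ {c ℓ} (F : Field c ℓ) {s : ℕ} (C : Circuit F s) → MultDisjoint F C →
    Σ ℕ λ N → Σ ℕ λ k → Σ (RSBP F N k) λ G →
      (N ≤ 2 * s * (s + 1) + 3 * s) ×
      ((v : Fin s) →
        Σ (Fin N) λ v₋ → Σ (Fin N) λ v₊ → Σ ℕ λ m →
          (m ≤ 4 * ∣ subGates F C v ∣) ×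
          IsPathPoly F G v₋ v₊ m (poly F C v) ×
          ((m′ : ℕ) → m′ < m → (xs : List (Fin N)) → ¬ StackWalk F G v₋ v₊ m′ xs))
proposition12 F {zero} C md = 0 , 0 , record { edge = λ () } , z≤n , λ ()
proposition12 F {suc s′} C md =
  N , N , program , N≤ , λ v → let open AtGate v in v₋ , v₊ , m , m≤ , pathPoly , no-shorter
  where open Simulation F C md
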